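{- Parallel reduction on (untyped) $\lambda\mu$T-terms has the diamond property: if $t_1\Rightarrow t_2$ and $t_1\Rightarrow t_3$, then there exists a term $t_4$ with $t_2\Rightarrow t_4$ and $t_3\Rightarrow t_4$.
   Context: $\lambda\mu$T raw terms/commands: $t,r,s ::= x\mid\lambda x.r\mid ts\mid\mu\alpha.c\mid0\mid\mathsf S\,t\mid\mathsf{nrec}\ r\ s\ t$, $c::=[\alpha]t$ ($x$ $\lambda$-variables, $\alpha$ $\mu$-variables, up to bound renaming); $\mathrm{FCV}$: free $\mu$-variables; $\overline n:=\mathsf S^n0$. Contexts $E ::= \Box \mid E\,t \mid \mathsf S\,E \mid \mathsf{nrec}\ r\ s\ E$; singular contexts $E^s ::= \Box t\mid\mathsf S\Box\mid\mathsf{nrec}\ r\ s\ \Box$; $E[t]$ fills the hole. Structural substitution $t[\alpha:=\beta E]$ replaces recursively each subcommand $[\alpha]q$ of $t$ by $[\beta]E[q[\alpha:=\beta E]]$ (capture-avoiding). Parallel reduction $\Rightarrow$ on terms, commands and contexts is defined mutually inductively by: (t1) $x\Rightarrow x$; (t2) $0\Rightarrow0$; (t3) $t\Rightarrow t'$ gives $\lambda x.t\Rightarrow\lambda x.t'$; (t4) if $t\Rightarrow t'$ and $E^s\Rightarrow E'$ with $E^s$ singular, then $E^s[t]\Rightarrow E'[t']$; (t5) if $t\Rightarrow t'$, $r\Rightarrow r'$ then $(\lambda x.t)r\Rightarrow t'[x:=r']$; (t6) if $c\Rightarrow c'$, $E\Rightarrow E'$ then $E[\mu\alpha.c]\Rightarrow\mu\alpha.c'[\alpha:=\alpha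 E']$; (t7) if $t\Rightarrow t'$ and $\alpha\notin\mathrm{FCV}(t)$ then $\mu\alpha.[\alpha]t\Rightarrow t'$; (t8) if $r\Rightarrow r'$ then $\mathsf{nrec}\ r\ s\ 0\Rightarrow r'$; (t9) if $r\Rightarrow r'$, $s\Rightarrow s'$ then $\mathsf{nrec}\ r\ s\ (\mathsf S\overline n)\Rightarrow s'\ \overline n\ (\mathsf{nrec}\ r'\ s'\ \overline n)$; (c1) if $t\Rightarrow t'$ then $[\alpha]t\Rightarrow[\alpha]t'$; (c2) if $c\Rightarrow c'$, $E\Rightarrow E'$ then $[\alpha]E[\mu\beta.c]\Rightarrow c'[\beta:=\alpha E']$; (E1) $\Box\Rightarrow\Box$; (E2) $E\Rightarrow E'$, $t\Rightarrow t'$ give $Et\Rightarrow E't'$; (E3) $E\Rightarrow E'$ gives $\mathsf SE\Rightarrow\mathsf SE'$; (E4) $E\Rightarrow E'$, $r\Rightarrow r'$, $s\Rightarrow s'$ give $\mathsf{nrec}\ r\ s\ E\Rightarrow\mathsf{nrec}\ r'\ s'\ E'$. -}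

module Defs where

-- λμT raw terms in de Bruijn notation (two separate index spaces:
-- λ-variables and μ-variables).  Terms up to bound renaming = de Bruijn.

open import Data.Nat using (ℕ; zero; suc)
open import Data.Product using (_×_; _,_; proj₁; proj₂)

infixl 7 _·_

mutual
  data Tm : Set where
    `_   : ℕ → Tm
    ƛ_   : Tm → Tm                -- λx.r   (binds λ-index 0)
    _·_  : Tm → Tm → Tm
    μ_   : Cmd → Tm               -- μα.c   (binds μ-index 0)
    𝟘    : Tm
    S_   : Tm → Tm
    nrec : Tm → Tm → Tm → Tm

  data Cmd : Set where
    [_]_ : ℕ → Tm → Cmd

num : ℕ → Tm
num zero    = 𝟘
num (suc n) = S (num n)

data Ctx : Set where
  □     : Ctx
  _·E_  : Ctx → Tm → Ctx
  SE    : Ctx → Ctx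
  nrecE : Tm → Tm → Ctx → Ctx

plug : Ctx → Tm → Tm
plug □             t = t
plug (E ·E u)      t = plug E t · u
plug (SE E)        t = S (plug E t)
plug (nrecE r s E) t = nrec r s (plug E t)

data Singular : Ctx → Set where
  sing-app  : ∀ u → Singular (□ ·E u)
  sing-S    : Singular (SE □)
  sing-nrec : ∀ r s → Singular (nrecE r s □)

ext : (ℕ → ℕ) → ℕ → ℕ
ext ρ zero    = zero
ext ρ (suc n) = suc (ρ n)

mutual
  renλ : (ℕ → ℕ) → Tm → Tm
  renλ ρ (` x)        = ` ρ x
  renλ ρ (ƛ t)        = ƛ renλ (ext ρ) t
  renλ ρ (t · u)      = renλ ρ t · renλ ρ u
  renλ ρ (μ c)        = μ renλc ρ c
  renλ ρ 𝟘            = 𝟘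
  renλ ρ (S t)        = S renλ ρ t
  renλ ρ (nrec r s t) = nrec (renλ ρ r) (renλ ρ s) (renλ ρ t)

  renλc : (ℕ → ℕ) → Cmd → Cmd
  renλc ρ ([ α ] t) = [ α ] renλ ρ t

renλE : (ℕ → ℕ) → Ctx → Ctx
renλE ρ □             = □
renλE ρ (E ·E u)      = renλE ρ E ·E renλ ρ u
renλE ρ (SE E)        = SE (renλE ρ E)
renλE ρ (nrecE r s E) = nrecE (renλ ρ r) (renλ ρ s) (renλE ρ E)

mutual
  renμ : (ℕ → ℕ) → Tm → Tm
  renμ ρ (` x)        = ` x
  renμ ρ (ƛ t)        = ƛ renμ ρ t
  renμ ρ (t · u)      = renμ ρ t · renμ ρ u
  renμ ρ (μ c)        = μ renμc (ext ρ) c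
  renμ ρ 𝟘            = 𝟘
  renμ ρ (S t)        = S renμ ρ t
  renμ ρ (nrec r s t) = nrec (renμ ρ r) (renμ ρ s) (renμ ρ t)

  renμc : (ℕ → ℕ) → Cmd → Cmd
  renμc ρ ([ α ] t) = [ ρ α ] renμ ρ t

renμE : (ℕ → ℕ) → Ctx → Ctx
renμE ρ □             = □
renμE ρ (E ·E u)      = renμE ρ E ·E renμ ρ u
renμE ρ (SE E)        = SE (renμE ρ E)
renμE ρ (nrecE r s E) = nrecE (renμ ρ r) (renμ ρ s) (renμE ρ E)

extsλ : (ℕ → Tm) → ℕ → Tm
extsλ σ zero    = ` zero
extsλ σ (suc n) = renλ suc (σ n)

mutual
  substλ : (ℕ → Tm) → Tm → Tm
  substλ σ (` x)        = σ x
  substλ σ (ƛ t)        = ƛ substλ (extsλ σ) t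
  substλ σ (t · u)      = substλ σ t · substλ σ u
  substλ σ (μ c)        = μ substλc (λ n → renμ suc (σ n)) c
  substλ σ 𝟘            = 𝟘
  substλ σ (S t)        = S substλ σ t
  substλ σ (nrec r s t) = nrec (substλ σ r) (substλ σ s) (substλ σ t)

  substλc : (ℕ → Tm) → Cmd → Cmd
  substλc σ ([ α ] t) = [ α ] substλ σ t

single : Tm → ℕ → Tm
single r zero    = r
single r (suc n) = ` n

_[0:=_] : Tm → Tm → Tm
t [0:= r ] = substλ (single r) t

-- Structural substitution, in simultaneous form: σ α = (β , E) means that
-- every subcommand [α]q is replaced by [β]E[q[σ]] (recursively).
SSub : Set
SSub = ℕ → ℕ × Ctx

liftλ : SSub → SSub
liftλ σ n = proj₁ (σ n) , renλE suc (proj₂ (σ n))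

liftμ : SSub → SSub
liftμ σ zero    = zero , □
liftμ σ (suc n) = suc (proj₁ (σ n)) , renμE suc (proj₂ (σ n))

mutual
  ssub : SSub → Tm → Tm
  ssub σ (` x)        = ` x
  ssub σ (ƛ t)        = ƛ ssub (liftλ σ) t
  ssub σ (t · u)      = ssub σ t · ssub σ u
  ssub σ (μ c)        = μ ssubc (liftμ σ) c
  ssub σ 𝟘            = 𝟘
  ssub σ (S t)        = S ssub σ t
  ssub σ (nrec r s t) = nrec (ssub σ r) (ssub σ s) (ssub σ t)

  ssubc : SSub → Cmd → Cmd
  ssubc σ ([ α ] t) = [ proj₁ (σ α) ] plug (proj₂ (σ α)) (ssub σ t)

-- c[α:=α E] where α is the μ-index 0 bound by the surrounding μ and E lives
-- outside that binder (so it is weakened); other μ-variables unchanged.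
sself : Ctx → SSub
sself E zero    = zero , renμE suc E
sself E (suc n) = suc n , □

-- c[β:=α E] where β is the μ-index 0 of c, being removed (outer indices
-- shift down), and α, E live in the outer scope.
sout : ℕ → Ctx → SSub
sout α E zero    = α , E
sout α E (suc n) = n , □

infix 4 _⇒_ _⇒c_ _⇒E_

mutual
  data _⇒_ : Tm → Tm → Set where
    t1 : ∀ {x} → ` x ⇒ ` x
    t2 : 𝟘 ⇒ 𝟘
    t3 : ∀ {t t'} → t ⇒ t' → ƛ t ⇒ ƛ t'
    t4 : ∀ {E E' t t'} → Singular E → t ⇒ t' → E ⇒E E' → plug E t ⇒ plug E' t'
    t5 : ∀ {t t' r r'} → t ⇒ t' → r ⇒ r' → (ƛ t) · r ⇒ t' [0:= r' ]
    t6 : ∀ {c c' E E'} → c ⇒c c' → E ⇒E E' →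
         plug E (μ c) ⇒ μ ssubc (sself E') c'
    -- μα.[α]t ⇒ t' with α ∉ FCV(t): t is the weakening of a term u of the
    -- outer scope (this is exactly α ∉ FCV(t) in de Bruijn form)
    t7 : ∀ {u u'} → u ⇒ u' → μ ([ zero ] renμ suc u) ⇒ u'
    t8 : ∀ {r r' s} → r ⇒ r' → nrec r s 𝟘 ⇒ r'
    t9 : ∀ {r r' s s' n} → r ⇒ r' → s ⇒ s' →
         nrec r s (S num n) ⇒ s' · num n · nrec r' s' (num n)

  data _⇒c_ : Cmd → Cmd → Set where
    c1 : ∀ {α t t'} → t ⇒ t' → [ α ] t ⇒c [ α ] t'
    c2 : ∀ {α c c' E E'} → c ⇒c c' → E ⇒E E' →
         [ α ] plug E (μ c) ⇒c ssubc (sout α E') c'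

  data _⇒E_ : Ctx → Ctx → Set where
    E1 : □ ⇒E □
    E2 : ∀ {E E' t t'} → E ⇒E E' → t ⇒ t' → E ·E t ⇒E E' ·E t'
    E3 : ∀ {E E'} → E ⇒E E' → SE E ⇒E SE E'
    E4 : ∀ {E E' r r' s s'} → E ⇒E E' → r ⇒ r' → s ⇒ s' →
         nrecE r s E ⇒E nrecE r' s' E'

-- We use Takahashi's method of complete developments: for every term t we
-- construct a term t* such that every parallel reduct of t reduces to t* in
-- one parallel step (the triangle property, `Tri t t*`).  Two reducts of t
-- then both reduce to t*, which is the diamond property.
module Submission where

open import Defs
open import Data.Product using (Σ; _×_)
open import Data.Product using (_,_; proj₁; proj₂)
open import Data.Nat using (ℕ; zero; suc; pred; _+_; _≤_; _≡ᵇ_)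
open import Data.Nat.Properties
  using (≤-refl; ≤-trans; ≤-pred; n≤1+n; m+n≤o⇒m≤o; m+n≤o⇒n≤o; +-suc; +-assoc; +-commutativeSemigroup;
         suc-injective; ≡ᵇ⇒≡; ≡⇒≡ᵇ)
open import Data.Bool using (Bool; true; false; _∨_; T)
open import Data.Bool.Properties using (∨-conicalˡ; ∨-conicalʳ)
open import Algebra.Properties.CommutativeSemigroup +-commutativeSemigroup using (xy∙z≈xz∙y)
open import Data.Sum using (_⊎_; inj₁; inj₂)
open import Data.Empty using (⊥; ⊥-elim)
open import Relation.Nullary using (¬_)
open import Relation.Binary.PropositionalEquality hiding ([_])

cong₃ : ∀ {A B C D : Set} (f : A → B → C → D) {a a' b b' c c'} →
        a ≡ a' → b ≡ b' → c ≡ c' → f a b c ≡ f a' b' c'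
cong₃ f refl refl refl = refl

app-injective : ∀ {t t' u u'} → t · u ≡ t' · u' → (t ≡ t') × (u ≡ u')
app-injective refl = refl , refl

S-injective : ∀ {t t'} → S t ≡ S t' → t ≡ t'
S-injective refl = refl

nrec-injective : ∀ {r r' s s' t t'} → nrec r s t ≡ nrec r' s' t' →
                 (r ≡ r') × (s ≡ s') × (t ≡ t')
nrec-injective refl = refl , refl , refl

cmd-injective : ∀ {α α' t t'} → [ α ] t ≡ [ α' ] t' → (α ≡ α') × (t ≡ t')
cmd-injective refl = refl , refl

num-injective : ∀ m n → num m ≡ num n → m ≡ n
num-injective zero    zero    eq = refl
num-injective zero    (suc n) ()
num-injective (suc m) zero    ()
num-injective (suc m) (suc n) eq = cong suc (num-injective m n (S-injective eq))

compose : Ctx → Ctx → Ctx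
compose □             B = B
compose (A ·E u)      B = compose A B ·E u
compose (SE A)        B = SE (compose A B)
compose (nrecE r s A) B = nrecE r s (compose A B)

plug-compose : ∀ A B t → plug (compose A B) t ≡ plug A (plug B t)
plug-compose □             B t = refl
plug-compose (A ·E u)      B t = cong (_· u) (plug-compose A B t)
plug-compose (SE A)        B t = cong S_ (plug-compose A B t)
plug-compose (nrecE r s A) B t = cong (nrec r s) (plug-compose A B t)

compose-□ : ∀ A → compose A □ ≡ A
compose-□ □             = refl
compose-□ (A ·E u)      = cong (_·E u) (compose-□ A)
compose-□ (SE A)        = cong SE (compose-□ A)
compose-□ (nrecE r s A) = cong (nrecE r s) (compose-□ A)

compose-assoc : ∀ A B C → compose (compose A B) C ≡ compose A (compose B C)
compose-assoc □             B C = refl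
compose-assoc (A ·E u)      B C = cong (_·E u) (compose-assoc A B C)
compose-assoc (SE A)        B C = cong SE (compose-assoc A B C)
compose-assoc (nrecE r s A) B C = cong (nrecE r s) (compose-assoc A B C)

substλE : (ℕ → Tm) → Ctx → Ctx
substλE σ □             = □
substλE σ (E ·E u)      = substλE σ E ·E substλ σ u
substλE σ (SE E)        = SE (substλE σ E)
substλE σ (nrecE r s E) = nrecE (substλ σ r) (substλ σ s) (substλE σ E)

ssubE : SSub → Ctx → Ctx
ssubE σ □             = □
ssubE σ (E ·E u)      = ssubE σ E ·E ssub σ u
ssubE σ (SE E)        = SE (ssubE σ E)
ssubE σ (nrecE r s E) = nrecE (ssub σ r) (ssub σ s) (ssubE σ E)

-- Renamings.  All laws are stated for renamings that agree pointwise, so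
-- that they apply to ext, suc and composites without function
-- extensionality.
ext-fuse : ∀ {ρ ρ' ρ''} → (∀ x → ρ (ρ' x) ≡ ρ'' x) → ∀ x → ext ρ (ext ρ' x) ≡ ext ρ'' x
ext-fuse h zero = refl
ext-fuse h (suc x) = cong suc (h x)

ext-id : ∀ {ρ} → (∀ x → ρ x ≡ x) → ∀ x → ext ρ x ≡ x
ext-id h zero = refl
ext-id h (suc x) = cong suc (h x)

mutual
  renλ-fuse : ∀ {ρ ρ' ρ''} → (∀ x → ρ (ρ' x) ≡ ρ'' x) → ∀ t → renλ ρ (renλ ρ' t) ≡ renλ ρ'' t
  renλ-fuse h (` x) = cong `_ (h x)
  renλ-fuse h (ƛ t) = cong ƛ_ (renλ-fuse (ext-fuse h) t)
  renλ-fuse h (t · u) = cong₂ _·_ (renλ-fuse h t) (renλ-fuse h u)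
  renλ-fuse h (μ c) = cong μ_ (renλc-fuse h c)
  renλ-fuse h 𝟘 = refl
  renλ-fuse h (S t) = cong S_ (renλ-fuse h t)
  renλ-fuse h (nrec r s t) = cong₃ nrec (renλ-fuse h r) (renλ-fuse h s) (renλ-fuse h t)

  renλc-fuse : ∀ {ρ ρ' ρ''} → (∀ x → ρ (ρ' x) ≡ ρ'' x) → ∀ c → renλc ρ (renλc ρ' c) ≡ renλc ρ'' c
  renλc-fuse h ([ α ] t) = cong ([ α ]_) (renλ-fuse h t)

mutual
  renμ-fuse : ∀ {ρ ρ' ρ''} → (∀ x → ρ (ρ' x) ≡ ρ'' x) → ∀ t → renμ ρ (renμ ρ' t) ≡ renμ ρ'' t
  renμ-fuse h (` x) = refl
  renμ-fuse h (ƛ t) = cong ƛ_ (renμ-fuse h t)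
  renμ-fuse h (t · u) = cong₂ _·_ (renμ-fuse h t) (renμ-fuse h u)
  renμ-fuse h (μ c) = cong μ_ (renμc-fuse (ext-fuse h) c)
  renμ-fuse h 𝟘 = refl
  renμ-fuse h (S t) = cong S_ (renμ-fuse h t)
  renμ-fuse h (nrec r s t) = cong₃ nrec (renμ-fuse h r) (renμ-fuse h s) (renμ-fuse h t)

  renμc-fuse : ∀ {ρ ρ' ρ''} → (∀ x → ρ (ρ' x) ≡ ρ'' x) → ∀ c → renμc ρ (renμc ρ' c) ≡ renμc ρ'' c
  renμc-fuse h ([ α ] t) = cong₂ [_]_ (h α) (renμ-fuse h t)

mutual
  renμ-id : ∀ {ρ} → (∀ x → ρ x ≡ x) → ∀ t → renμ ρ t ≡ t
  renμ-id h (` x) = refl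
  renμ-id h (ƛ t) = cong ƛ_ (renμ-id h t)
  renμ-id h (t · u) = cong₂ _·_ (renμ-id h t) (renμ-id h u)
  renμ-id h (μ c) = cong μ_ (renμc-id (ext-id h) c)
  renμ-id h 𝟘 = refl
  renμ-id h (S t) = cong S_ (renμ-id h t)
  renμ-id h (nrec r s t) = cong₃ nrec (renμ-id h r) (renμ-id h s) (renμ-id h t)

  renμc-id : ∀ {ρ} → (∀ x → ρ x ≡ x) → ∀ c → renμc ρ c ≡ c
  renμc-id h ([ α ] t) = cong₂ [_]_ (h α) (renμ-id h t)

mutual
  renλμ : ∀ ρ ρ' t → renλ ρ (renμ ρ' t) ≡ renμ ρ' (renλ ρ t)
  renλμ ρ ρ' (` x) = refl
  renλμ ρ ρ' (ƛ t) = cong ƛ_ (renλμ (ext ρ) ρ' t)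
  renλμ ρ ρ' (t · u) = cong₂ _·_ (renλμ ρ ρ' t) (renλμ ρ ρ' u)
  renλμ ρ ρ' (μ c) = cong μ_ (renλμc ρ (ext ρ') c)
  renλμ ρ ρ' 𝟘 = refl
  renλμ ρ ρ' (S t) = cong S_ (renλμ ρ ρ' t)
  renλμ ρ ρ' (nrec r s t) = cong₃ nrec (renλμ ρ ρ' r) (renλμ ρ ρ' s) (renλμ ρ ρ' t)

  renλμc : ∀ ρ ρ' c → renλc ρ (renμc ρ' c) ≡ renμc ρ' (renλc ρ c)
  renλμc ρ ρ' ([ α ] t) = cong ([ ρ' α ]_) (renλμ ρ ρ' t)

renλE-fuse : ∀ {ρ ρ' ρ''} → (∀ x → ρ (ρ' x) ≡ ρ'' x) → ∀ E → renλE ρ (renλE ρ' E) ≡ renλE ρ'' E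
renλE-fuse h □ = refl
renλE-fuse h (E ·E u) = cong₂ _·E_ (renλE-fuse h E) (renλ-fuse h u)
renλE-fuse h (SE E) = cong SE (renλE-fuse h E)
renλE-fuse h (nrecE r s E) = cong₃ nrecE (renλ-fuse h r) (renλ-fuse h s) (renλE-fuse h E)

renμE-fuse : ∀ {ρ ρ' ρ''} → (∀ x → ρ (ρ' x) ≡ ρ'' x) → ∀ E → renμE ρ (renμE ρ' E) ≡ renμE ρ'' E
renμE-fuse h □ = refl
renμE-fuse h (E ·E u) = cong₂ _·E_ (renμE-fuse h E) (renμ-fuse h u)
renμE-fuse h (SE E) = cong SE (renμE-fuse h E)
renμE-fuse h (nrecE r s E) = cong₃ nrecE (renμ-fuse h r) (renμ-fuse h s) (renμE-fuse h E)

renμE-id : ∀ {ρ} → (∀ x → ρ x ≡ x) → ∀ E → renμE ρ E ≡ E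
renμE-id h □ = refl
renμE-id h (E ·E u) = cong₂ _·E_ (renμE-id h E) (renμ-id h u)
renμE-id h (SE E) = cong SE (renμE-id h E)
renμE-id h (nrecE r s E) = cong₃ nrecE (renμ-id h r) (renμ-id h s) (renμE-id h E)

renλμE : ∀ ρ ρ' E → renλE ρ (renμE ρ' E) ≡ renμE ρ' (renλE ρ E)
renλμE ρ ρ' □ = refl
renλμE ρ ρ' (E ·E u) = cong₂ _·E_ (renλμE ρ ρ' E) (renλμ ρ ρ' u)
renλμE ρ ρ' (SE E) = cong SE (renλμE ρ ρ' E)
renλμE ρ ρ' (nrecE r s E) = cong₃ nrecE (renλμ ρ ρ' r) (renλμ ρ ρ' s) (renλμE ρ ρ' E)

renλ-plug : ∀ ρ E t → renλ ρ (plug E t) ≡ plug (renλE ρ E) (renλ ρ t)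
renλ-plug ρ □ t = refl
renλ-plug ρ (E ·E u) t = cong (_· renλ ρ u) (renλ-plug ρ E t)
renλ-plug ρ (SE E) t = cong S_ (renλ-plug ρ E t)
renλ-plug ρ (nrecE r s E) t = cong (nrec (renλ ρ r) (renλ ρ s)) (renλ-plug ρ E t)

renμ-plug : ∀ ρ E t → renμ ρ (plug E t) ≡ plug (renμE ρ E) (renμ ρ t)
renμ-plug ρ □ t = refl
renμ-plug ρ (E ·E u) t = cong (_· renμ ρ u) (renμ-plug ρ E t)
renμ-plug ρ (SE E) t = cong S_ (renμ-plug ρ E t)
renμ-plug ρ (nrecE r s E) t = cong (nrec (renμ ρ r) (renμ ρ s)) (renμ-plug ρ E t)

substλ-plug : ∀ σ E t → substλ σ (plug E t) ≡ plug (substλE σ E) (substλ σ t)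
substλ-plug σ □ t = refl
substλ-plug σ (E ·E u) t = cong (_· substλ σ u) (substλ-plug σ E t)
substλ-plug σ (SE E) t = cong S_ (substλ-plug σ E t)
substλ-plug σ (nrecE r s E) t = cong (nrec (substλ σ r) (substλ σ s)) (substλ-plug σ E t)

ssub-plug : ∀ σ E t → ssub σ (plug E t) ≡ plug (ssubE σ E) (ssub σ t)
ssub-plug σ □ t = refl
ssub-plug σ (E ·E u) t = cong (_· ssub σ u) (ssub-plug σ E t)
ssub-plug σ (SE E) t = cong S_ (ssub-plug σ E t)
ssub-plug σ (nrecE r s E) t = cong (nrec (ssub σ r) (ssub σ s)) (ssub-plug σ E t)

renλE-compose : ∀ ρ A B → renλE ρ (compose A B) ≡ compose (renλE ρ A) (renλE ρ B)
renλE-compose ρ □ B = refl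
renλE-compose ρ (A ·E u) B = cong (_·E renλ ρ u) (renλE-compose ρ A B)
renλE-compose ρ (SE A) B = cong SE (renλE-compose ρ A B)
renλE-compose ρ (nrecE r s A) B = cong (nrecE (renλ ρ r) (renλ ρ s)) (renλE-compose ρ A B)

renμE-compose : ∀ ρ A B → renμE ρ (compose A B) ≡ compose (renμE ρ A) (renμE ρ B)
renμE-compose ρ □ B = refl
renμE-compose ρ (A ·E u) B = cong (_·E renμ ρ u) (renμE-compose ρ A B)
renμE-compose ρ (SE A) B = cong SE (renμE-compose ρ A B)
renμE-compose ρ (nrecE r s A) B = cong (nrecE (renμ ρ r) (renμ ρ s)) (renμE-compose ρ A B)

mutual
  sub-ren : ∀ {σ ρ σ'} → (∀ x → σ (ρ x) ≡ σ' x) → ∀ t → substλ σ (renλ ρ t) ≡ substλ σ' t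
  sub-ren h (` x) = h x
  sub-ren {σ} {ρ} {σ'} h (ƛ t) = cong ƛ_ (sub-ren lifted-ƛ t)
    where lifted-ƛ : ∀ x → extsλ σ (ext ρ x) ≡ extsλ σ' x
          lifted-ƛ zero = refl
          lifted-ƛ (suc x) = cong (renλ suc) (h x)
  sub-ren h (t · u) = cong₂ _·_ (sub-ren h t) (sub-ren h u)
  sub-ren h (μ c) = cong μ_ (subc-ren (λ x → cong (renμ suc) (h x)) c)
  sub-ren h 𝟘 = refl
  sub-ren h (S t) = cong S_ (sub-ren h t)
  sub-ren h (nrec r s t) = cong₃ nrec (sub-ren h r) (sub-ren h s) (sub-ren h t)

  subc-ren : ∀ {σ ρ σ'} → (∀ x → σ (ρ x) ≡ σ' x) → ∀ c → substλc σ (renλc ρ c) ≡ substλc σ' c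
  subc-ren h ([ α ] t) = cong ([ α ]_) (sub-ren h t)

mutual
  ren-sub : ∀ {ρ σ σ'} → (∀ x → renλ ρ (σ x) ≡ σ' x) → ∀ t → renλ ρ (substλ σ t) ≡ substλ σ' t
  ren-sub h (` x) = h x
  ren-sub {ρ} {σ} {σ'} h (ƛ t) = cong ƛ_ (ren-sub lifted-ƛ t)
    where lifted-ƛ : ∀ x → renλ (ext ρ) (extsλ σ x) ≡ extsλ σ' x
          lifted-ƛ zero = refl
          lifted-ƛ (suc x) = trans (renλ-fuse (λ _ → refl) (σ x))
                        (sym (trans (cong (renλ suc) (sym (h x))) (renλ-fuse (λ _ → refl) (σ x))))
  ren-sub h (t · u) = cong₂ _·_ (ren-sub h t) (ren-sub h u)
  ren-sub {ρ} {σ} h (μ c) = cong μ_ (renc-sub (λ x → trans (renλμ ρ suc (σ x)) (cong (renμ suc) (h x))) c)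
  ren-sub h 𝟘 = refl
  ren-sub h (S t) = cong S_ (ren-sub h t)
  ren-sub h (nrec r s t) = cong₃ nrec (ren-sub h r) (ren-sub h s) (ren-sub h t)

  renc-sub : ∀ {ρ σ σ'} → (∀ x → renλ ρ (σ x) ≡ σ' x) → ∀ c → renλc ρ (substλc σ c) ≡ substλc σ' c
  renc-sub h ([ α ] t) = cong ([ α ]_) (ren-sub h t)

mutual
  renμ-sub : ∀ {ρ σ σ'} → (∀ x → renμ ρ (σ x) ≡ σ' x) → ∀ t → renμ ρ (substλ σ t) ≡ substλ σ' (renμ ρ t)
  renμ-sub h (` x) = h x
  renμ-sub {ρ} {σ} {σ'} h (ƛ t) = cong ƛ_ (renμ-sub lifted-ƛ t)
    where lifted-ƛ : ∀ x → renμ ρ (extsλ σ x) ≡ extsλ σ' x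
          lifted-ƛ zero = refl
          lifted-ƛ (suc x) = trans (sym (renλμ suc ρ (σ x))) (cong (renλ suc) (h x))
  renμ-sub h (t · u) = cong₂ _·_ (renμ-sub h t) (renμ-sub h u)
  renμ-sub {σ = σ} h (μ c) = cong μ_ (renμc-sub (λ x → trans (renμ-fuse (λ _ → refl) (σ x))
                        (sym (trans (cong (renμ suc) (sym (h x))) (renμ-fuse (λ _ → refl) (σ x))))) c)
  renμ-sub h 𝟘 = refl
  renμ-sub h (S t) = cong S_ (renμ-sub h t)
  renμ-sub h (nrec r s t) = cong₃ nrec (renμ-sub h r) (renμ-sub h s) (renμ-sub h t)

  renμc-sub : ∀ {ρ σ σ'} → (∀ x → renμ ρ (σ x) ≡ σ' x) → ∀ c → renμc ρ (substλc σ c) ≡ substλc σ' (renμc ρ c)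
  renμc-sub h ([ α ] t) = cong ([ _ ]_) (renμ-sub h t)

mutual
  sub-sub : ∀ {σ τ υ} → (∀ x → substλ σ (τ x) ≡ υ x) → ∀ t → substλ σ (substλ τ t) ≡ substλ υ t
  sub-sub h (` x) = h x
  sub-sub {σ} {τ} {υ} h (ƛ t) = cong ƛ_ (sub-sub lifted-ƛ t)
    where lifted-ƛ : ∀ x → substλ (extsλ σ) (extsλ τ x) ≡ extsλ υ x
          lifted-ƛ zero = refl
          lifted-ƛ (suc x) = trans (sub-ren (λ _ → refl) (τ x))
                        (trans (sym (ren-sub (λ _ → refl) (τ x))) (cong (renλ suc) (h x)))
  sub-sub h (t · u) = cong₂ _·_ (sub-sub h t) (sub-sub h u)
  sub-sub {τ = τ} h (μ c) =
    cong μ_ (subc-sub (λ x → trans (sym (renμ-sub (λ _ → refl) (τ x))) (cong (renμ suc) (h x))) c)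
  sub-sub h 𝟘 = refl
  sub-sub h (S t) = cong S_ (sub-sub h t)
  sub-sub h (nrec r s t) = cong₃ nrec (sub-sub h r) (sub-sub h s) (sub-sub h t)

  subc-sub : ∀ {σ τ υ} → (∀ x → substλ σ (τ x) ≡ υ x) → ∀ c → substλc σ (substλc τ c) ≡ substλc υ c
  subc-sub h ([ α ] t) = cong ([ α ]_) (sub-sub h t)

mutual
  sub-id : ∀ {σ} → (∀ x → σ x ≡ ` x) → ∀ t → substλ σ t ≡ t
  sub-id h (` x) = h x
  sub-id {σ} h (ƛ t) = cong ƛ_ (sub-id lifted-ƛ t)
    where lifted-ƛ : ∀ x → extsλ σ x ≡ ` x
          lifted-ƛ zero = refl
          lifted-ƛ (suc x) = cong (renλ suc) (h x)
  sub-id h (t · u) = cong₂ _·_ (sub-id h t) (sub-id h u)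
  sub-id h (μ c) = cong μ_ (subc-id (λ x → cong (renμ suc) (h x)) c)
  sub-id h 𝟘 = refl
  sub-id h (S t) = cong S_ (sub-id h t)
  sub-id h (nrec r s t) = cong₃ nrec (sub-id h r) (sub-id h s) (sub-id h t)

  subc-id : ∀ {σ} → (∀ x → σ x ≡ ` x) → ∀ c → substλc σ c ≡ c
  subc-id h ([ α ] t) = cong ([ α ]_) (sub-id h t)

subE-ren : ∀ {σ ρ σ'} → (∀ x → σ (ρ x) ≡ σ' x) → ∀ E → substλE σ (renλE ρ E) ≡ substλE σ' E
subE-ren h □ = refl
subE-ren h (E ·E u) = cong₂ _·E_ (subE-ren h E) (sub-ren h u)
subE-ren h (SE E) = cong SE (subE-ren h E)
subE-ren h (nrecE r s E) = cong₃ nrecE (sub-ren h r) (sub-ren h s) (subE-ren h E)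

renE-sub : ∀ {ρ σ σ'} → (∀ x → renλ ρ (σ x) ≡ σ' x) → ∀ E → renλE ρ (substλE σ E) ≡ substλE σ' E
renE-sub h □ = refl
renE-sub h (E ·E u) = cong₂ _·E_ (renE-sub h E) (ren-sub h u)
renE-sub h (SE E) = cong SE (renE-sub h E)
renE-sub h (nrecE r s E) = cong₃ nrecE (ren-sub h r) (ren-sub h s) (renE-sub h E)

renμE-sub : ∀ {ρ σ σ'} → (∀ x → renμ ρ (σ x) ≡ σ' x) → ∀ E → renμE ρ (substλE σ E) ≡ substλE σ' (renμE ρ E)
renμE-sub h □ = refl
renμE-sub h (E ·E u) = cong₂ _·E_ (renμE-sub h E) (renμ-sub h u)
renμE-sub h (SE E) = cong SE (renμE-sub h E)
renμE-sub h (nrecE r s E) = cong₃ nrecE (renμ-sub h r) (renμ-sub h s) (renμE-sub h E)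

subE-id : ∀ {σ} → (∀ x → σ x ≡ ` x) → ∀ E → substλE σ E ≡ E
subE-id h □ = refl
subE-id h (E ·E u) = cong₂ _·E_ (subE-id h E) (sub-id h u)
subE-id h (SE E) = cong SE (subE-id h E)
subE-id h (nrecE r s E) = cong₃ nrecE (sub-id h r) (sub-id h s) (subE-id h E)

_⊙_ : SSub → SSub → SSub
(τ ⊙ σ) n = proj₁ (τ (proj₁ (σ n))) , compose (proj₂ (τ (proj₁ (σ n)))) (ssubE τ (proj₂ (σ n)))

mutual
  ssub-id : ∀ {σ} → (∀ n → σ n ≡ (n , □)) → ∀ t → ssub σ t ≡ t
  ssub-id h (` x) = refl
  ssub-id h (ƛ t) = cong ƛ_ (ssub-id (λ n → cong (λ p → proj₁ p , renλE suc (proj₂ p)) (h n)) t)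
  ssub-id h (t · u) = cong₂ _·_ (ssub-id h t) (ssub-id h u)
  ssub-id {σ} h (μ c) = cong μ_ (ssubc-id lifted-μ c)
    where lifted-μ : ∀ n → liftμ σ n ≡ (n , □)
          lifted-μ zero = refl
          lifted-μ (suc n) = cong (λ p → suc (proj₁ p) , renμE suc (proj₂ p)) (h n)
  ssub-id h 𝟘 = refl
  ssub-id h (S t) = cong S_ (ssub-id h t)
  ssub-id h (nrec r s t) = cong₃ nrec (ssub-id h r) (ssub-id h s) (ssub-id h t)

  ssubc-id : ∀ {σ} → (∀ n → σ n ≡ (n , □)) → ∀ c → ssubc σ c ≡ c
  ssubc-id h ([ α ] t) rewrite h α = cong ([ α ]_) (ssub-id h t)

mutual
  ssub-renλ : ∀ {ρ σ σ'} → (∀ n → σ' n ≡ (proj₁ (σ n) , renλE ρ (proj₂ (σ n)))) →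
              ∀ t → renλ ρ (ssub σ t) ≡ ssub σ' (renλ ρ t)
  ssub-renλ h (` x) = refl
  ssub-renλ {ρ} {σ} {σ'} h (ƛ t) = cong ƛ_ (ssub-renλ lifted-ƛ t)
    where lifted-ƛ : ∀ n → liftλ σ' n ≡ (proj₁ (liftλ σ n) , renλE (ext ρ) (proj₂ (liftλ σ n)))
          lifted-ƛ n rewrite h n = cong (proj₁ (σ n) ,_) (trans (renλE-fuse (λ _ → refl) (proj₂ (σ n)))
                                    (sym (renλE-fuse (λ _ → refl) (proj₂ (σ n)))))
  ssub-renλ h (t · u) = cong₂ _·_ (ssub-renλ h t) (ssub-renλ h u)
  ssub-renλ {ρ} {σ} {σ'} h (μ c) = cong μ_ (ssubc-renλ lifted-μ c)
    where lifted-μ : ∀ n → liftμ σ' n ≡ (proj₁ (liftμ σ n) , renλE ρ (proj₂ (liftμ σ n)))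
          lifted-μ zero = refl
          lifted-μ (suc n) rewrite h n = cong (suc (proj₁ (σ n)) ,_) (sym (renλμE ρ suc (proj₂ (σ n))))
  ssub-renλ h 𝟘 = refl
  ssub-renλ h (S t) = cong S_ (ssub-renλ h t)
  ssub-renλ h (nrec r s t) = cong₃ nrec (ssub-renλ h r) (ssub-renλ h s) (ssub-renλ h t)

  ssubc-renλ : ∀ {ρ σ σ'} → (∀ n → σ' n ≡ (proj₁ (σ n) , renλE ρ (proj₂ (σ n)))) →
              ∀ c → renλc ρ (ssubc σ c) ≡ ssubc σ' (renλc ρ c)
  ssubc-renλ {ρ} {σ} h ([ α ] t) rewrite h α =
    cong ([ _ ]_) (trans (renλ-plug ρ (proj₂ (σ α)) (ssub σ t)) (cong (plug _) (ssub-renλ h t)))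

mutual
  renμ-ssub : ∀ {ρ σ σ'} → (∀ n → σ' n ≡ (ρ (proj₁ (σ n)) , renμE ρ (proj₂ (σ n)))) →
              ∀ t → renμ ρ (ssub σ t) ≡ ssub σ' t
  renμ-ssub h (` x) = refl
  renμ-ssub {ρ} {σ} {σ'} h (ƛ t) = cong ƛ_ (renμ-ssub lifted-ƛ t)
    where lifted-ƛ : ∀ n → liftλ σ' n ≡ (ρ (proj₁ (liftλ σ n)) , renμE ρ (proj₂ (liftλ σ n)))
          lifted-ƛ n rewrite h n = cong (ρ (proj₁ (σ n)) ,_) (renλμE suc ρ (proj₂ (σ n)))
  renμ-ssub h (t · u) = cong₂ _·_ (renμ-ssub h t) (renμ-ssub h u)
  renμ-ssub {ρ} {σ} {σ'} h (μ c) = cong μ_ (renμc-ssub lifted-μ c)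
    where lifted-μ : ∀ n → liftμ σ' n ≡ (ext ρ (proj₁ (liftμ σ n)) , renμE (ext ρ) (proj₂ (liftμ σ n)))
          lifted-μ zero = refl
          lifted-μ (suc n) rewrite h n = cong (suc (ρ (proj₁ (σ n))) ,_) (trans (renμE-fuse (λ _ → refl) (proj₂ (σ n)))
                                    (sym (renμE-fuse (λ _ → refl) (proj₂ (σ n)))))
  renμ-ssub h 𝟘 = refl
  renμ-ssub h (S t) = cong S_ (renμ-ssub h t)
  renμ-ssub h (nrec r s t) = cong₃ nrec (renμ-ssub h r) (renμ-ssub h s) (renμ-ssub h t)

  renμc-ssub : ∀ {ρ σ σ'} → (∀ n → σ' n ≡ (ρ (proj₁ (σ n)) , renμE ρ (proj₂ (σ n)))) →
              ∀ c → renμc ρ (ssubc σ c) ≡ ssubc σ' c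
  renμc-ssub {ρ} {σ} h ([ α ] t) rewrite h α =
    cong ([ _ ]_) (trans (renμ-plug ρ (proj₂ (σ α)) (ssub σ t)) (cong (plug _) (renμ-ssub h t)))

mutual
  ssub-renμ : ∀ {ρ σ σ'} → (∀ n → σ (ρ n) ≡ σ' n) → ∀ t → ssub σ (renμ ρ t) ≡ ssub σ' t
  ssub-renμ h (` x) = refl
  ssub-renμ h (ƛ t) = cong ƛ_ (ssub-renμ (λ n → cong (λ p → proj₁ p , renλE suc (proj₂ p)) (h n)) t)
  ssub-renμ h (t · u) = cong₂ _·_ (ssub-renμ h t) (ssub-renμ h u)
  ssub-renμ {ρ} {σ} {σ'} h (μ c) = cong μ_ (ssubc-renμ lifted-μ c)
    where lifted-μ : ∀ n → liftμ σ (ext ρ n) ≡ liftμ σ' n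
          lifted-μ zero = refl
          lifted-μ (suc n) = cong (λ p → suc (proj₁ p) , renμE suc (proj₂ p)) (h n)
  ssub-renμ h 𝟘 = refl
  ssub-renμ h (S t) = cong S_ (ssub-renμ h t)
  ssub-renμ h (nrec r s t) = cong₃ nrec (ssub-renμ h r) (ssub-renμ h s) (ssub-renμ h t)

  ssubc-renμ : ∀ {ρ σ σ'} → (∀ n → σ (ρ n) ≡ σ' n) → ∀ c → ssubc σ (renμc ρ c) ≡ ssubc σ' c
  ssubc-renμ h ([ α ] t) rewrite h α = cong ([ _ ]_) (cong (plug _) (ssub-renμ h t))

ssubE-id : ∀ {σ} → (∀ n → σ n ≡ (n , □)) → ∀ E → ssubE σ E ≡ E
ssubE-id h □ = refl
ssubE-id h (E ·E u) = cong₂ _·E_ (ssubE-id h E) (ssub-id h u)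
ssubE-id h (SE E) = cong SE (ssubE-id h E)
ssubE-id h (nrecE r s E) = cong₃ nrecE (ssub-id h r) (ssub-id h s) (ssubE-id h E)

ssubE-renλ : ∀ {ρ σ σ'} → (∀ n → σ' n ≡ (proj₁ (σ n) , renλE ρ (proj₂ (σ n)))) →
              ∀ E → renλE ρ (ssubE σ E) ≡ ssubE σ' (renλE ρ E)
ssubE-renλ h □ = refl
ssubE-renλ h (E ·E u) = cong₂ _·E_ (ssubE-renλ h E) (ssub-renλ h u)
ssubE-renλ h (SE E) = cong SE (ssubE-renλ h E)
ssubE-renλ h (nrecE r s E) = cong₃ nrecE (ssub-renλ h r) (ssub-renλ h s) (ssubE-renλ h E)

renμE-ssub : ∀ {ρ σ σ'} → (∀ n → σ' n ≡ (ρ (proj₁ (σ n)) , renμE ρ (proj₂ (σ n)))) →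
              ∀ E → renμE ρ (ssubE σ E) ≡ ssubE σ' E
renμE-ssub h □ = refl
renμE-ssub h (E ·E u) = cong₂ _·E_ (renμE-ssub h E) (renμ-ssub h u)
renμE-ssub h (SE E) = cong SE (renμE-ssub h E)
renμE-ssub h (nrecE r s E) = cong₃ nrecE (renμ-ssub h r) (renμ-ssub h s) (renμE-ssub h E)

ssubE-renμ : ∀ {ρ σ σ'} → (∀ n → σ (ρ n) ≡ σ' n) → ∀ E → ssubE σ (renμE ρ E) ≡ ssubE σ' E
ssubE-renμ h □ = refl
ssubE-renμ h (E ·E u) = cong₂ _·E_ (ssubE-renμ h E) (ssub-renμ h u)
ssubE-renμ h (SE E) = cong SE (ssubE-renμ h E)
ssubE-renμ h (nrecE r s E) = cong₃ nrecE (ssub-renμ h r) (ssub-renμ h s) (ssubE-renμ h E)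

liftμ-wk : ∀ τ F → ssubE (liftμ τ) (renμE suc F) ≡ renμE suc (ssubE τ F)
liftμ-wk τ F = trans (ssubE-renμ (λ _ → refl) F) (sym (renμE-ssub (λ _ → refl) F))

liftμ-wkt : ∀ τ t → ssub (liftμ τ) (renμ suc t) ≡ renμ suc (ssub τ t)
liftμ-wkt τ t = trans (ssub-renμ (λ _ → refl) t) (sym (renμ-ssub (λ _ → refl) t))

liftλ-wk : ∀ τ F → ssubE (liftλ τ) (renλE suc F) ≡ renλE suc (ssubE τ F)
liftλ-wk τ F = sym (ssubE-renλ (λ _ → refl) F)

liftλ-wkt : ∀ τ t → ssub (liftλ τ) (renλ suc t) ≡ renλ suc (ssub τ t)
liftλ-wkt τ t = sym (ssub-renλ (λ _ → refl) t)

mutual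
  ssub-ssub : ∀ {τ σ υ} → (∀ n → υ n ≡ (τ ⊙ σ) n) → ∀ t → ssub τ (ssub σ t) ≡ ssub υ t
  ssub-ssub h (` x) = refl
  ssub-ssub {τ} {σ} {υ} h (ƛ t) = cong ƛ_ (ssub-ssub lifted-ƛ t)
    where lifted-ƛ : ∀ n → liftλ υ n ≡ (liftλ τ ⊙ liftλ σ) n
          lifted-ƛ n rewrite h n = cong (proj₁ (τ (proj₁ (σ n))) ,_)
             (trans (renλE-compose suc (proj₂ (τ (proj₁ (σ n)))) _)
                    (cong (compose _) (sym (liftλ-wk τ (proj₂ (σ n))))))
  ssub-ssub h (t · u) = cong₂ _·_ (ssub-ssub h t) (ssub-ssub h u)
  ssub-ssub {τ} {σ} {υ} h (μ c) = cong μ_ (ssubc-ssub lifted-μ c)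
    where lifted-μ : ∀ n → liftμ υ n ≡ (liftμ τ ⊙ liftμ σ) n
          lifted-μ zero = refl
          lifted-μ (suc n) rewrite h n = cong (suc (proj₁ (τ (proj₁ (σ n)))) ,_)
             (trans (renμE-compose suc (proj₂ (τ (proj₁ (σ n)))) _)
                    (cong (compose _) (sym (liftμ-wk τ (proj₂ (σ n))))))
  ssub-ssub h 𝟘 = refl
  ssub-ssub h (S t) = cong S_ (ssub-ssub h t)
  ssub-ssub h (nrec r s t) = cong₃ nrec (ssub-ssub h r) (ssub-ssub h s) (ssub-ssub h t)

  ssubc-ssub : ∀ {τ σ υ} → (∀ n → υ n ≡ (τ ⊙ σ) n) → ∀ c → ssubc τ (ssubc σ c) ≡ ssubc υ c
  ssubc-ssub {τ} {σ} h ([ α ] t) rewrite h α =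
    cong ([ _ ]_) (trans (cong (plug (proj₂ (τ (proj₁ (σ α))))) (ssub-plug τ (proj₂ (σ α)) (ssub σ t)))
                  (trans (sym (plug-compose (proj₂ (τ (proj₁ (σ α)))) (ssubE τ (proj₂ (σ α))) _))
                         (cong (plug _) (ssub-ssub h t))))

ssubc-commute : ∀ {τ σ τ' σ'} → (∀ n → (τ ⊙ σ) n ≡ (τ' ⊙ σ') n) → ∀ c → ssubc τ (ssubc σ c) ≡ ssubc τ' (ssubc σ' c)
ssubc-commute h c = trans (ssubc-ssub (λ n → refl) c) (sym (ssubc-ssub h c))

renλ-sub-ext : ∀ τ F → renλE suc (substλE τ F) ≡ substλE (extsλ τ) (renλE suc F)
renλ-sub-ext τ F = trans (renE-sub (λ _ → refl) F) (sym (subE-ren (λ _ → refl) F))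

mutual
  sub-ssub : ∀ {τ σ σ' τ'} → (∀ n → σ' n ≡ (proj₁ (σ n) , substλE τ (proj₂ (σ n)))) →
             (∀ x → ssub σ' (τ' x) ≡ τ x) →
             ∀ t → substλ τ (ssub σ t) ≡ ssub σ' (substλ τ' t)
  sub-ssub hσ hτ (` x) = sym (hτ x)
  sub-ssub {τ} {σ} {σ'} {τ'} hσ hτ (ƛ t) = cong ƛ_ (sub-ssub lifted-σ lifted-τ t)
    where lifted-σ : ∀ n → liftλ σ' n ≡ (proj₁ (liftλ σ n) , substλE (extsλ τ) (proj₂ (liftλ σ n)))
          lifted-σ n rewrite hσ n = cong (proj₁ (σ n) ,_) (renλ-sub-ext τ (proj₂ (σ n)))
          lifted-τ : ∀ x → ssub (liftλ σ') (extsλ τ' x) ≡ extsλ τ x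
          lifted-τ zero = refl
          lifted-τ (suc x) = trans (liftλ-wkt σ' (τ' x)) (cong (renλ suc) (hτ x))
  sub-ssub hσ hτ (t · u) = cong₂ _·_ (sub-ssub hσ hτ t) (sub-ssub hσ hτ u)
  sub-ssub {τ} {σ} {σ'} {τ'} hσ hτ (μ c) = cong μ_ (subc-ssub lifted-σ lifted-τ c)
    where lifted-σ : ∀ n → liftμ σ' n ≡ (proj₁ (liftμ σ n) , substλE (λ x → renμ suc (τ x)) (proj₂ (liftμ σ n)))
          lifted-σ zero = refl
          lifted-σ (suc n) rewrite hσ n = cong (suc (proj₁ (σ n)) ,_) (renμE-sub (λ _ → refl) (proj₂ (σ n)))
          lifted-τ : ∀ x → ssub (liftμ σ') (renμ suc (τ' x)) ≡ renμ suc (τ x)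
          lifted-τ x = trans (liftμ-wkt σ' (τ' x)) (cong (renμ suc) (hτ x))
  sub-ssub hσ hτ 𝟘 = refl
  sub-ssub hσ hτ (S t) = cong S_ (sub-ssub hσ hτ t)
  sub-ssub hσ hτ (nrec r s t) = cong₃ nrec (sub-ssub hσ hτ r) (sub-ssub hσ hτ s) (sub-ssub hσ hτ t)

  subc-ssub : ∀ {τ σ σ' τ'} → (∀ n → σ' n ≡ (proj₁ (σ n) , substλE τ (proj₂ (σ n)))) →
             (∀ x → ssub σ' (τ' x) ≡ τ x) →
             ∀ c → substλc τ (ssubc σ c) ≡ ssubc σ' (substλc τ' c)
  subc-ssub {τ} {σ} hσ hτ ([ α ] t) rewrite hσ α =
    cong ([ _ ]_) (trans (substλ-plug τ (proj₂ (σ α)) (ssub σ t)) (cong (plug _) (sub-ssub hσ hτ t)))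

mutual
  ssub-sub : ∀ {σ τ σ'' υ} → (∀ n → σ n ≡ (proj₁ (σ'' n) , substλE υ (proj₂ (σ'' n)))) →
             (∀ x → ssub σ (τ x) ≡ υ x) →
             ∀ t → ssub σ (substλ τ t) ≡ substλ υ (ssub σ'' t)
  ssub-sub hσ hτ (` x) = hτ x
  ssub-sub {σ} {τ} {σ''} {υ} hσ hτ (ƛ t) = cong ƛ_ (ssub-sub lifted-σ lifted-τ t)
    where lifted-σ : ∀ n → liftλ σ n ≡ (proj₁ (liftλ σ'' n) , substλE (extsλ υ) (proj₂ (liftλ σ'' n)))
          lifted-σ n rewrite hσ n = cong (proj₁ (σ'' n) ,_) (renλ-sub-ext υ (proj₂ (σ'' n)))
          lifted-τ : ∀ x → ssub (liftλ σ) (extsλ τ x) ≡ extsλ υ x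
          lifted-τ zero = refl
          lifted-τ (suc x) = trans (liftλ-wkt σ (τ x)) (cong (renλ suc) (hτ x))
  ssub-sub hσ hτ (t · u) = cong₂ _·_ (ssub-sub hσ hτ t) (ssub-sub hσ hτ u)
  ssub-sub {σ} {τ} {σ''} {υ} hσ hτ (μ c) = cong μ_ (ssubc-sub lifted-σ lifted-τ c)
    where lifted-σ : ∀ n → liftμ σ n ≡ (proj₁ (liftμ σ'' n) , substλE (λ x → renμ suc (υ x)) (proj₂ (liftμ σ'' n)))
          lifted-σ zero = refl
          lifted-σ (suc n) rewrite hσ n = cong (suc (proj₁ (σ'' n)) ,_) (renμE-sub (λ _ → refl) (proj₂ (σ'' n)))
          lifted-τ : ∀ x → ssub (liftμ σ) (renμ suc (τ x)) ≡ renμ suc (υ x)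
          lifted-τ x = trans (liftμ-wkt σ (τ x)) (cong (renμ suc) (hτ x))
  ssub-sub hσ hτ 𝟘 = refl
  ssub-sub hσ hτ (S t) = cong S_ (ssub-sub hσ hτ t)
  ssub-sub hσ hτ (nrec r s t) = cong₃ nrec (ssub-sub hσ hτ r) (ssub-sub hσ hτ s) (ssub-sub hσ hτ t)

  ssubc-sub : ∀ {σ τ σ'' υ} → (∀ n → σ n ≡ (proj₁ (σ'' n) , substλE υ (proj₂ (σ'' n)))) →
             (∀ x → ssub σ (τ x) ≡ υ x) →
             ∀ c → ssubc σ (substλc τ c) ≡ substλc υ (ssubc σ'' c)
  ssubc-sub {σ'' = σ''} {υ} hσ hτ ([ α ] t) rewrite hσ α =
    cong ([ _ ]_) (trans (cong (plug _) (ssub-sub hσ hτ t)) (sym (substλ-plug υ (proj₂ (σ'' α)) (ssub σ'' t))))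

renμ-as-ssub : ∀ ρ t → renμ ρ t ≡ ssub (λ n → ρ n , □) t
renμ-as-ssub ρ t = trans (cong (renμ ρ) (sym (ssub-id (λ _ → refl) t))) (renμ-ssub (λ _ → refl) t)

renμE-as-ssub : ∀ ρ E → renμE ρ E ≡ ssubE (λ n → ρ n , □) E
renμE-as-ssub ρ E = trans (cong (renμE ρ) (sym (ssubE-id (λ _ → refl) E))) (renμE-ssub (λ _ → refl) E)

ssub-wk : ∀ {σ ρ} → (∀ n → σ (suc n) ≡ (ρ n , □)) → ∀ t → ssub σ (renμ suc t) ≡ renμ ρ t
ssub-wk h t = trans (ssub-renμ h t) (sym (renμ-as-ssub _ t))

ssubE-wk : ∀ {σ ρ} → (∀ n → σ (suc n) ≡ (ρ n , □)) → ∀ E → ssubE σ (renμE suc E) ≡ renμE ρ E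
ssubE-wk h E = trans (ssubE-renμ h E) (sym (renμE-as-ssub _ E))

sself-wk : ∀ X t → ssub (sself X) (renμ suc t) ≡ renμ suc t
sself-wk X t = ssub-wk (λ _ → refl) t

sself-wkE : ∀ X E → ssubE (sself X) (renμE suc E) ≡ renμE suc E
sself-wkE X E = ssubE-wk (λ _ → refl) E

sout-wk : ∀ α X t → ssub (sout α X) (renμ suc t) ≡ t
sout-wk α X t = trans (ssub-wk (λ _ → refl) t) (renμ-id (λ _ → refl) t)

sout-wkE : ∀ α X E → ssubE (sout α X) (renμE suc E) ≡ E
sout-wkE α X E = trans (ssubE-wk (λ _ → refl) E) (renμE-id (λ _ → refl) E)

-- Equations between the specific structural substitutions produced by the
-- reduction rules t6 and c2.
-- c[α:=αB][α:=αA] = c[α:=α(A∘B)]: two successive μ-steps on a spine fuse.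
sself-fuse : ∀ A B c → ssubc (sself A) (ssubc (sself B) c) ≡ ssubc (sself (compose A B)) c
sself-fuse A B c = ssubc-ssub pointwise c
  where pointwise : ∀ n → sself (compose A B) n ≡ (sself A ⊙ sself B) n
        pointwise zero = cong (zero ,_) (trans (renμE-compose suc A B) (cong (compose _) (sym (sself-wkE A B))))
        pointwise (suc n) = refl

sout-sself-fuse : ∀ α A B c → ssubc (sout α A) (ssubc (sself B) c) ≡ ssubc (sout α (compose A B)) c
sout-sself-fuse α A B c = ssubc-ssub pointwise c
  where pointwise : ∀ n → sout α (compose A B) n ≡ (sout α A ⊙ sself B) n
        pointwise zero = cong (α ,_) (cong (compose A) (sym (sout-wkE α A B)))
        pointwise (suc n) = refl

sout-lift : ∀ X d → ssubc (sout zero (renμE suc X)) (renμc (ext suc) d) ≡ ssubc (sself X) d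
sout-lift X d = ssubc-renμ pointwise d
  where pointwise : ∀ n → sout zero (renμE suc X) (ext suc n) ≡ sself X n
        pointwise zero = refl
        pointwise (suc n) = refl

sself-wrap : ∀ B w → ssubc (sself B) ([ zero ] renμ suc w) ≡ [ zero ] renμ suc (plug B w)
sself-wrap B w = cong ([ zero ]_) (trans (cong (plug (renμE suc B)) (sself-wk B w)) (sym (renμ-plug suc B w)))

num-renλ : ∀ ρ n → renλ ρ (num n) ≡ num n
num-renλ ρ zero = refl
num-renλ ρ (suc n) = cong S_ (num-renλ ρ n)

num-renμ : ∀ ρ n → renμ ρ (num n) ≡ num n
num-renμ ρ zero = refl
num-renμ ρ (suc n) = cong S_ (num-renμ ρ n)

num-substλ : ∀ σ n → substλ σ (num n) ≡ num n
num-substλ σ zero = refl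
num-substλ σ (suc n) = cong S_ (num-substλ σ n)

num-ssub : ∀ σ n → ssub σ (num n) ≡ num n
num-ssub σ zero = refl
num-ssub σ (suc n) = cong S_ (num-ssub σ n)

⇒-cast : ∀ {a a' b b'} → a ≡ a' → b ≡ b' → a ⇒ b → a' ⇒ b'
⇒-cast refl refl d = d

⇒c-cast : ∀ {a a' b b'} → a ≡ a' → b ≡ b' → a ⇒c b → a' ⇒c b'
⇒c-cast refl refl d = d

app⇒ : ∀ {t t' u u'} → t ⇒ t' → u ⇒ u' → t · u ⇒ t' · u'
app⇒ d e = t4 (sing-app _) d (E2 E1 e)

S⇒ : ∀ {t t'} → t ⇒ t' → S t ⇒ S t'
S⇒ d = t4 sing-S d (E3 E1)

nrec⇒ : ∀ {r r' s s' t t'} → r ⇒ r' → s ⇒ s' → t ⇒ t' → nrec r s t ⇒ nrec r' s' t'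
nrec⇒ a b d = t4 (sing-nrec _ _) d (E4 E1 a b)

plug⇒ : ∀ {E E' t t'} → E ⇒E E' → t ⇒ t' → plug E t ⇒ plug E' t'
plug⇒ E1 d = d
plug⇒ (E2 e u) d = app⇒ (plug⇒ e d) u
plug⇒ (E3 e) d = S⇒ (plug⇒ e d)
plug⇒ (E4 e r s) d = nrec⇒ r s (plug⇒ e d)

compose⇒ : ∀ {A A' B B'} → A ⇒E A' → B ⇒E B' → compose A B ⇒E compose A' B'
compose⇒ E1 b = b
compose⇒ (E2 a u) b = E2 (compose⇒ a b) u
compose⇒ (E3 a) b = E3 (compose⇒ a b)
compose⇒ (E4 a r s) b = E4 (compose⇒ a b) r s

-- Reflexivity; for μc it is the instance E = □ of rule t6, since
-- c[α:=α□] = c.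
sself-□ : ∀ n → sself □ n ≡ (n , □)
sself-□ zero = refl
sself-□ (suc n) = refl

mutual
  ⇒-refl : ∀ t → t ⇒ t
  ⇒-refl (` x) = t1
  ⇒-refl (ƛ t) = t3 (⇒-refl t)
  ⇒-refl (t · u) = app⇒ (⇒-refl t) (⇒-refl u)
  ⇒-refl (μ c) = ⇒-cast refl (cong μ_ (ssubc-id sself-□ c)) (t6 {E = □} (⇒c-refl c) E1)
  ⇒-refl 𝟘 = t2
  ⇒-refl (S t) = S⇒ (⇒-refl t)
  ⇒-refl (nrec r s t) = nrec⇒ (⇒-refl r) (⇒-refl s) (⇒-refl t)

  ⇒c-refl : ∀ c → c ⇒c c
  ⇒c-refl ([ α ] t) = c1 (⇒-refl t)

num⇒ : ∀ n → num n ⇒ num n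
num⇒ n = ⇒-refl (num n)

renλ-inst : ∀ ρ t r → renλ ρ (t [0:= r ]) ≡ (renλ (ext ρ) t) [0:= renλ ρ r ]
renλ-inst ρ t r = trans (ren-sub (λ _ → refl) t) (sym (sub-ren pointwise t))
  where pointwise : ∀ x → single (renλ ρ r) (ext ρ x) ≡ renλ ρ (single r x)
        pointwise zero = refl
        pointwise (suc x) = refl

renλ-sself : ∀ ρ E c → renλc ρ (ssubc (sself E) c) ≡ ssubc (sself (renλE ρ E)) (renλc ρ c)
renλ-sself ρ E c = ssubc-renλ pointwise c
  where pointwise : ∀ n → sself (renλE ρ E) n ≡ (proj₁ (sself E n) , renλE ρ (proj₂ (sself E n)))
        pointwise zero = cong (zero ,_) (sym (renλμE ρ suc E))
        pointwise (suc n) = refl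

renλ-sout : ∀ ρ α E c → renλc ρ (ssubc (sout α E) c) ≡ ssubc (sout α (renλE ρ E)) (renλc ρ c)
renλ-sout ρ α E c = ssubc-renλ pointwise c
  where pointwise : ∀ n → sout α (renλE ρ E) n ≡ (proj₁ (sout α E n) , renλE ρ (proj₂ (sout α E n)))
        pointwise zero = refl
        pointwise (suc n) = refl

singular-renλ : ∀ ρ {E} → Singular E → Singular (renλE ρ E)
singular-renλ ρ (sing-app u) = sing-app _
singular-renλ ρ sing-S = sing-S
singular-renλ ρ (sing-nrec r s) = sing-nrec _ _

mutual
  ⇒-renλ : ∀ ρ {t t'} → t ⇒ t' → renλ ρ t ⇒ renλ ρ t'
  ⇒-renλ ρ t1 = t1
  ⇒-renλ ρ t2 = t2
  ⇒-renλ ρ (t3 d) = t3 (⇒-renλ (ext ρ) d)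
  ⇒-renλ ρ (t4 {E} {E'} {t} {t'} sg d e) =
    ⇒-cast (sym (renλ-plug ρ E t)) (sym (renλ-plug ρ E' t')) (t4 (singular-renλ ρ sg) (⇒-renλ ρ d) (⇒E-renλ ρ e))
  ⇒-renλ ρ (t5 {t' = t'} {r' = r'} d e) = ⇒-cast refl (sym (renλ-inst ρ t' r')) (t5 (⇒-renλ (ext ρ) d) (⇒-renλ ρ e))
  ⇒-renλ ρ (t6 {c} {c'} {E} {E'} d e) =
    ⇒-cast (sym (renλ-plug ρ E (μ c))) (cong μ_ (sym (renλ-sself ρ E' c'))) (t6 (⇒c-renλ ρ d) (⇒E-renλ ρ e))
  ⇒-renλ ρ (t7 {u} d) = ⇒-cast (cong (λ z → μ ([ zero ] z)) (sym (renλμ ρ suc u))) refl (t7 (⇒-renλ ρ d))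
  ⇒-renλ ρ (t8 d) = t8 (⇒-renλ ρ d)
  ⇒-renλ ρ (t9 {n = n} d e) =
    ⇒-cast (cong (λ z → nrec _ _ (S z)) (sym (num-renλ ρ n)))
           (cong (λ z → _ · z · nrec _ _ z) (sym (num-renλ ρ n))) (t9 (⇒-renλ ρ d) (⇒-renλ ρ e))

  ⇒c-renλ : ∀ ρ {c c'} → c ⇒c c' → renλc ρ c ⇒c renλc ρ c'
  ⇒c-renλ ρ (c1 d) = c1 (⇒-renλ ρ d)
  ⇒c-renλ ρ (c2 {α} {c} {c'} {E} {E'} d e) =
    ⇒c-cast (cong ([ α ]_) (sym (renλ-plug ρ E (μ c)))) (sym (renλ-sout ρ α E' c')) (c2 (⇒c-renλ ρ d) (⇒E-renλ ρ e))

  ⇒E-renλ : ∀ ρ {E E'} → E ⇒E E' → renλE ρ E ⇒E renλE ρ E'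
  ⇒E-renλ ρ E1 = E1
  ⇒E-renλ ρ (E2 e d) = E2 (⇒E-renλ ρ e) (⇒-renλ ρ d)
  ⇒E-renλ ρ (E3 e) = E3 (⇒E-renλ ρ e)
  ⇒E-renλ ρ (E4 e d d') = E4 (⇒E-renλ ρ e) (⇒-renλ ρ d) (⇒-renλ ρ d')

renμ-inst : ∀ ρ t r → renμ ρ (t [0:= r ]) ≡ (renμ ρ t) [0:= renμ ρ r ]
renμ-inst ρ t r = renμ-sub pointwise t
  where pointwise : ∀ x → renμ ρ (single r x) ≡ single (renμ ρ r) x
        pointwise zero = refl
        pointwise (suc x) = refl

renμ-sself : ∀ ρ E c → renμc (ext ρ) (ssubc (sself E) c) ≡ ssubc (sself (renμE ρ E)) (renμc (ext ρ) c)
renμ-sself ρ E c = trans (renμc-ssub (λ _ → refl) c) (sym (ssubc-renμ pointwise c))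
  where pointwise : ∀ n → sself (renμE ρ E) (ext ρ n) ≡
                          (ext ρ (proj₁ (sself E n)) , renμE (ext ρ) (proj₂ (sself E n)))
        pointwise zero = cong (zero ,_) (trans (renμE-fuse (λ _ → refl) E) (sym (renμE-fuse (λ _ → refl) E)))
        pointwise (suc n) = refl

renμ-sout : ∀ ρ α E c → renμc ρ (ssubc (sout α E) c) ≡ ssubc (sout (ρ α) (renμE ρ E)) (renμc (ext ρ) c)
renμ-sout ρ α E c = trans (renμc-ssub (λ _ → refl) c) (sym (ssubc-renμ pointwise c))
  where pointwise : ∀ n → sout (ρ α) (renμE ρ E) (ext ρ n) ≡ (ρ (proj₁ (sout α E n)) , renμE ρ (proj₂ (sout α E n)))
        pointwise zero = refl
        pointwise (suc n) = refl

singular-renμ : ∀ ρ {E} → Singular E → Singular (renμE ρ E)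
singular-renμ ρ (sing-app u) = sing-app _
singular-renμ ρ sing-S = sing-S
singular-renμ ρ (sing-nrec r s) = sing-nrec _ _

renμ-wkfuse : ∀ ρ u → renμ (ext ρ) (renμ suc u) ≡ renμ suc (renμ ρ u)
renμ-wkfuse ρ u = trans (renμ-fuse (λ _ → refl) u) (sym (renμ-fuse (λ _ → refl) u))

mutual
  ⇒-renμ : ∀ ρ {t t'} → t ⇒ t' → renμ ρ t ⇒ renμ ρ t'
  ⇒-renμ ρ t1 = t1
  ⇒-renμ ρ t2 = t2
  ⇒-renμ ρ (t3 d) = t3 (⇒-renμ ρ d)
  ⇒-renμ ρ (t4 {E} {E'} {t} {t'} sg d e) =
    ⇒-cast (sym (renμ-plug ρ E t)) (sym (renμ-plug ρ E' t')) (t4 (singular-renμ ρ sg) (⇒-renμ ρ d) (⇒E-renμ ρ e))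
  ⇒-renμ ρ (t5 {t' = t'} {r' = r'} d e) = ⇒-cast refl (sym (renμ-inst ρ t' r')) (t5 (⇒-renμ ρ d) (⇒-renμ ρ e))
  ⇒-renμ ρ (t6 {c} {c'} {E} {E'} d e) =
    ⇒-cast (sym (renμ-plug ρ E (μ c))) (cong μ_ (sym (renμ-sself ρ E' c'))) (t6 (⇒c-renμ (ext ρ) d) (⇒E-renμ ρ e))
  ⇒-renμ ρ (t7 {u} d) = ⇒-cast (cong (λ z → μ ([ zero ] z)) (sym (renμ-wkfuse ρ u))) refl (t7 (⇒-renμ ρ d))
  ⇒-renμ ρ (t8 d) = t8 (⇒-renμ ρ d)
  ⇒-renμ ρ (t9 {n = n} d e) =
    ⇒-cast (cong (λ z → nrec _ _ (S z)) (sym (num-renμ ρ n)))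
           (cong (λ z → _ · z · nrec _ _ z) (sym (num-renμ ρ n))) (t9 (⇒-renμ ρ d) (⇒-renμ ρ e))

  ⇒c-renμ : ∀ ρ {c c'} → c ⇒c c' → renμc ρ c ⇒c renμc ρ c'
  ⇒c-renμ ρ (c1 d) = c1 (⇒-renμ ρ d)
  ⇒c-renμ ρ (c2 {α} {c} {c'} {E} {E'} d e) =
    ⇒c-cast (cong ([ ρ α ]_) (sym (renμ-plug ρ E (μ c)))) (sym (renμ-sout ρ α E' c'))
            (c2 (⇒c-renμ (ext ρ) d) (⇒E-renμ ρ e))

  ⇒E-renμ : ∀ ρ {E E'} → E ⇒E E' → renμE ρ E ⇒E renμE ρ E'
  ⇒E-renμ ρ E1 = E1
  ⇒E-renμ ρ (E2 e d) = E2 (⇒E-renμ ρ e) (⇒-renμ ρ d)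
  ⇒E-renμ ρ (E3 e) = E3 (⇒E-renμ ρ e)
  ⇒E-renμ ρ (E4 e d d') = E4 (⇒E-renμ ρ e) (⇒-renμ ρ d) (⇒-renμ ρ d')

sub-inst : ∀ σ t r → substλ σ (t [0:= r ]) ≡ (substλ (extsλ σ) t) [0:= substλ σ r ]
sub-inst σ t r = trans (sub-sub (λ _ → refl) t) (sym (sub-sub pointwise t))
  where pointwise : ∀ x → substλ (single (substλ σ r)) (extsλ σ x) ≡ substλ σ (single r x)
        pointwise zero = refl
        pointwise (suc x) = trans (sub-ren (λ _ → refl) (σ x)) (sub-id (λ _ → refl) (σ x))

sub-sself : ∀ σ E c → substλc (λ x → renμ suc (σ x)) (ssubc (sself E) c) ≡
                       ssubc (sself (substλE σ E)) (substλc (λ x → renμ suc (σ x)) c)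
sub-sself σ E c = subc-ssub pointwise (λ x → sself-wk _ (σ x)) c
  where pointwise : ∀ n → sself (substλE σ E) n ≡
                          (proj₁ (sself E n) , substλE (λ x → renμ suc (σ x)) (proj₂ (sself E n)))
        pointwise zero = cong (zero ,_) (renμE-sub (λ _ → refl) E)
        pointwise (suc n) = refl

sub-sout : ∀ σ α E c → substλc σ (ssubc (sout α E) c) ≡
                        ssubc (sout α (substλE σ E)) (substλc (λ x → renμ suc (σ x)) c)
sub-sout σ α E c = subc-ssub pointwise (λ x → sout-wk α _ (σ x)) c
  where pointwise : ∀ n → sout α (substλE σ E) n ≡ (proj₁ (sout α E n) , substλE σ (proj₂ (sout α E n)))
        pointwise zero = refl
        pointwise (suc n) = refl

singular-sub : ∀ σ {E} → Singular E → Singular (substλE σ E)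
singular-sub σ (sing-app u) = sing-app _
singular-sub σ sing-S = sing-S
singular-sub σ (sing-nrec r s) = sing-nrec _ _

SubR : (ℕ → Tm) → (ℕ → Tm) → Set
SubR σ σ' = ∀ x → σ x ⇒ σ' x

exts⇒ : ∀ {σ σ'} → SubR σ σ' → SubR (extsλ σ) (extsλ σ')
exts⇒ h zero = t1
exts⇒ h (suc x) = ⇒-renλ suc (h x)

mutual
  ⇒-sub : ∀ {σ σ'} → SubR σ σ' → ∀ {t t'} → t ⇒ t' → substλ σ t ⇒ substλ σ' t'
  ⇒-sub h (t1 {x}) = h x
  ⇒-sub h t2 = t2
  ⇒-sub h (t3 d) = t3 (⇒-sub (exts⇒ h) d)
  ⇒-sub {σ} {σ'} h (t4 {E} {E'} {t} {t'} sg d e) =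
    ⇒-cast (sym (substλ-plug σ E t)) (sym (substλ-plug σ' E' t')) (t4 (singular-sub σ sg) (⇒-sub h d) (⇒E-sub h e))
  ⇒-sub {σ' = σ'} h (t5 {t' = t'} {r' = r'} d e) =
    ⇒-cast refl (sym (sub-inst σ' t' r')) (t5 (⇒-sub (exts⇒ h) d) (⇒-sub h e))
  ⇒-sub {σ} {σ'} h (t6 {c} {c'} {E} {E'} d e) =
    ⇒-cast (sym (substλ-plug σ E (μ c))) (cong μ_ (sym (sub-sself σ' E' c')))
      (t6 (⇒c-sub (λ x → ⇒-renμ suc (h x)) d) (⇒E-sub h e))
  ⇒-sub h (t7 {u} d) =
    ⇒-cast (cong (λ z → μ ([ zero ] z)) (renμ-sub (λ _ → refl) u)) refl (t7 (⇒-sub h d))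
  ⇒-sub h (t8 d) = t8 (⇒-sub h d)
  ⇒-sub {σ} {σ'} h (t9 {n = n} d e) =
    ⇒-cast (cong (λ z → nrec _ _ (S z)) (sym (num-substλ σ n)))
           (cong (λ z → _ · z · nrec _ _ z) (sym (num-substλ σ' n))) (t9 (⇒-sub h d) (⇒-sub h e))

  ⇒c-sub : ∀ {σ σ'} → SubR σ σ' → ∀ {c c'} → c ⇒c c' → substλc σ c ⇒c substλc σ' c'
  ⇒c-sub h (c1 d) = c1 (⇒-sub h d)
  ⇒c-sub {σ} {σ'} h (c2 {α} {c} {c'} {E} {E'} d e) =
    ⇒c-cast (cong ([ α ]_) (sym (substλ-plug σ E (μ c)))) (sym (sub-sout σ' α E' c'))
      (c2 (⇒c-sub (λ x → ⇒-renμ suc (h x)) d) (⇒E-sub h e))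

  ⇒E-sub : ∀ {σ σ'} → SubR σ σ' → ∀ {E E'} → E ⇒E E' → substλE σ E ⇒E substλE σ' E'
  ⇒E-sub h E1 = E1
  ⇒E-sub h (E2 e d) = E2 (⇒E-sub h e) (⇒-sub h d)
  ⇒E-sub h (E3 e) = E3 (⇒E-sub h e)
  ⇒E-sub h (E4 e d d') = E4 (⇒E-sub h e) (⇒-sub h d) (⇒-sub h d')

⇒-inst : ∀ {t t' r r'} → t ⇒ t' → r ⇒ r' → t [0:= r ] ⇒ t' [0:= r' ]
⇒-inst d e = ⇒-sub pointwise d
  where pointwise : SubR (single _) (single _)
        pointwise zero = e
        pointwise (suc x) = t1

SSubR : SSub → SSub → Set
SSubR σ σ' = ∀ n → (proj₁ (σ n) ≡ proj₁ (σ' n)) × (proj₂ (σ n) ⇒E proj₂ (σ' n))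

liftλ⇒ : ∀ {σ σ'} → SSubR σ σ' → SSubR (liftλ σ) (liftλ σ')
liftλ⇒ h n = proj₁ (h n) , ⇒E-renλ suc (proj₂ (h n))

liftμ⇒ : ∀ {σ σ'} → SSubR σ σ' → SSubR (liftμ σ) (liftμ σ')
liftμ⇒ h zero = refl , E1
liftμ⇒ h (suc n) = cong suc (proj₁ (h n)) , ⇒E-renμ suc (proj₂ (h n))

ssub-inst : ∀ σ t r → ssub σ (t [0:= r ]) ≡ (ssub (liftλ σ) t) [0:= ssub σ r ]
ssub-inst σ t r = ssub-sub pointwise hτ t
  where pointwise : ∀ n → σ n ≡ (proj₁ (liftλ σ n) , substλE (single (ssub σ r)) (proj₂ (liftλ σ n)))
        pointwise n = cong (proj₁ (σ n) ,_)
          (sym (trans (subE-ren (λ _ → refl) (proj₂ (σ n))) (subE-id (λ _ → refl) (proj₂ (σ n)))))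
        hτ : ∀ x → ssub σ (single r x) ≡ single (ssub σ r) x
        hτ zero = refl
        hτ (suc x) = refl

ssub-sself : ∀ σ E c → ssubc (liftμ σ) (ssubc (sself E) c) ≡ ssubc (sself (ssubE σ E)) (ssubc (liftμ σ) c)
ssub-sself σ E c = ssubc-commute pointwise c
  where pointwise : ∀ n → (liftμ σ ⊙ sself E) n ≡ (sself (ssubE σ E) ⊙ liftμ σ) n
        pointwise zero = cong (zero ,_) (trans (liftμ-wk σ E) (sym (compose-□ _)))
        pointwise (suc n) = cong (suc (proj₁ (σ n)) ,_) (trans (compose-□ _) (sym (sself-wkE _ (proj₂ (σ n)))))

ssub-sout : ∀ σ α E c → ssubc σ (ssubc (sout α E) c) ≡
            ssubc (sout (proj₁ (σ α)) (compose (proj₂ (σ α)) (ssubE σ E))) (ssubc (liftμ σ) c)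
ssub-sout σ α E c = ssubc-commute pointwise c
  where pointwise : ∀ n → (σ ⊙ sout α E) n ≡ (sout (proj₁ (σ α)) (compose (proj₂ (σ α)) (ssubE σ E)) ⊙ liftμ σ) n
        pointwise zero = cong (proj₁ (σ α) ,_) (sym (compose-□ _))
        pointwise (suc n) = cong (proj₁ (σ n) ,_) (trans (compose-□ _) (sym (sout-wkE _ _ (proj₂ (σ n)))))

singular-ssub : ∀ σ {E} → Singular E → Singular (ssubE σ E)
singular-ssub σ (sing-app u) = sing-app _
singular-ssub σ sing-S = sing-S
singular-ssub σ (sing-nrec r s) = sing-nrec _ _

mutual
  ⇒-ssub : ∀ {σ σ'} → SSubR σ σ' → ∀ {t t'} → t ⇒ t' → ssub σ t ⇒ ssub σ' t'
  ⇒-ssub h t1 = t1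
  ⇒-ssub h t2 = t2
  ⇒-ssub h (t3 d) = t3 (⇒-ssub (liftλ⇒ h) d)
  ⇒-ssub {σ} {σ'} h (t4 {E} {E'} {t} {t'} sg d e) =
    ⇒-cast (sym (ssub-plug σ E t)) (sym (ssub-plug σ' E' t')) (t4 (singular-ssub σ sg) (⇒-ssub h d) (⇒E-ssub h e))
  ⇒-ssub {σ' = σ'} h (t5 {t' = t'} {r' = r'} d e) =
    ⇒-cast refl (sym (ssub-inst σ' t' r')) (t5 (⇒-ssub (liftλ⇒ h) d) (⇒-ssub h e))
  ⇒-ssub {σ} {σ'} h (t6 {c} {c'} {E} {E'} d e) =
    ⇒-cast (sym (ssub-plug σ E (μ c))) (cong μ_ (sym (ssub-sself σ' E' c')))
      (t6 (⇒c-ssub (liftμ⇒ h) d) (⇒E-ssub h e))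
  ⇒-ssub {σ} h (t7 {u} d) =
    ⇒-cast (cong (λ z → μ ([ zero ] z)) (sym (liftμ-wkt σ u))) refl (t7 (⇒-ssub h d))
  ⇒-ssub h (t8 d) = t8 (⇒-ssub h d)
  ⇒-ssub {σ} {σ'} h (t9 {n = n} d e) =
    ⇒-cast (cong (λ z → nrec _ _ (S z)) (sym (num-ssub σ n)))
           (cong (λ z → _ · z · nrec _ _ z) (sym (num-ssub σ' n))) (t9 (⇒-ssub h d) (⇒-ssub h e))

  ⇒c-ssub : ∀ {σ σ'} → SSubR σ σ' → ∀ {c c'} → c ⇒c c' → ssubc σ c ⇒c ssubc σ' c'
  ⇒c-ssub {σ' = σ'} h (c1 {α} {t' = t'} d) =
    ⇒c-cast refl (cong (λ z → [ z ] plug (proj₂ (σ' α)) (ssub σ' t')) (proj₁ (h α)))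
      (c1 (plug⇒ (proj₂ (h α)) (⇒-ssub h d)))
  ⇒c-ssub {σ} {σ'} h (c2 {α} {c} {c'} {E} {E'} d e) =
    ⇒c-cast (cong ([ proj₁ (σ α) ]_) (trans (plug-compose (proj₂ (σ α)) (ssubE σ E) _)
                                             (cong (plug (proj₂ (σ α))) (sym (ssub-plug σ E (μ c))))))
            (trans (cong (λ z → ssubc (sout z _) _) (proj₁ (h α))) (sym (ssub-sout σ' α E' c')))
      (c2 (⇒c-ssub (liftμ⇒ h) d) (compose⇒ (proj₂ (h α)) (⇒E-ssub h e)))

  ⇒E-ssub : ∀ {σ σ'} → SSubR σ σ' → ∀ {E E'} → E ⇒E E' → ssubE σ E ⇒E ssubE σ' E'
  ⇒E-ssub h E1 = E1
  ⇒E-ssub h (E2 e d) = E2 (⇒E-ssub h e) (⇒-ssub h d)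
  ⇒E-ssub h (E3 e) = E3 (⇒E-ssub h e)
  ⇒E-ssub h (E4 e d d') = E4 (⇒E-ssub h e) (⇒-ssub h d) (⇒-ssub h d')

-- Head-μ terms: the terms of the form E[μc].  Rules t6 and c2 fire exactly
-- at such terms, so this is the decisive case distinction of the proof.
headμ : Tm → Bool
headμ (` x)        = false
headμ (ƛ t)        = false
headμ (t · u)      = headμ t
headμ (μ c)        = true
headμ 𝟘            = false
headμ (S t)        = headμ t
headμ (nrec r s t) = headμ t

headμ-plug : ∀ E t → headμ (plug E t) ≡ headμ t
headμ-plug □             t = refl
headμ-plug (E ·E u)      t = headμ-plug E t
headμ-plug (SE E)        t = headμ-plug E t
headμ-plug (nrecE r s E) t = headμ-plug E t

headμ-num : ∀ n → headμ (num n) ≡ false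
headμ-num zero    = refl
headμ-num (suc n) = headμ-num n

true≢false : true ≢ false
true≢false ()

not-headμ : ∀ {E c t} → plug E (μ c) ≡ t → headμ t ≡ false → ⊥
not-headμ {E} {c} refl h = true≢false (trans (sym (headμ-plug E (μ c))) h)

headμ-decompose : ∀ t → headμ t ≡ true → Σ Ctx λ E → Σ Cmd λ c → t ≡ plug E (μ c)
headμ-decompose (μ c) h = □ , c , refl
headμ-decompose (t · u) h with headμ-decompose t h
... | E , c , eq = (E ·E u) , c , cong (_· u) eq
headμ-decompose (S t) h with headμ-decompose t h
... | E , c , eq = SE E , c , cong S_ eq
headμ-decompose (nrec r s t) h with headμ-decompose t h
... | E , c , eq = nrecE r s E , c , cong (nrec r s) eq

plugμ-injective : ∀ E E' c c' → plug E (μ c) ≡ plug E' (μ c') → (E ≡ E') × (c ≡ c')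
plugμ-injective □ □ c c' refl = refl , refl
plugμ-injective (E ·E u) (E' ·E u') c c' eq with app-injective eq
... | eqE , refl with plugμ-injective E E' c c' eqE
...   | refl , refl = refl , refl
plugμ-injective (SE E) (SE E') c c' eq with plugμ-injective E E' c c' (S-injective eq)
... | refl , refl = refl , refl
plugμ-injective (nrecE r s E) (nrecE r' s' E') c c' eq with nrec-injective eq
... | refl , refl , eqE with plugμ-injective E E' c c' eqE
...   | refl , refl = refl , refl
plugμ-injective □             (_ ·E _)      c c' ()
plugμ-injective □             (SE _)        c c' ()
plugμ-injective □             (nrecE _ _ _) c c' ()
plugμ-injective (_ ·E _)      □             c c' ()
plugμ-injective (_ ·E _)      (SE _)        c c' ()
plugμ-injective (_ ·E _)      (nrecE _ _ _) c c' ()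
plugμ-injective (SE _)        □             c c' ()
plugμ-injective (SE _)        (_ ·E _)      c c' ()
plugμ-injective (SE _)        (nrecE _ _ _) c c' ()
plugμ-injective (nrecE _ _ _) □             c c' ()
plugμ-injective (nrecE _ _ _) (_ ·E _)      c c' ()
plugμ-injective (nrecE _ _ _) (SE _)        c c' ()

plug-split : ∀ F A c u → plug A (μ c) ≡ plug F u →
             Σ Ctx λ H → (A ≡ compose F H) × (u ≡ plug H (μ c))
plug-split □ A c u eq = A , refl , sym eq
plug-split (F ·E w) (A ·E w') c u eq with app-injective eq
... | eqA , refl with plug-split F A c u eqA
...   | H , refl , e = H , refl , e
plug-split (SE F) (SE A) c u eq with plug-split F A c u (S-injective eq)
... | H , refl , e = H , refl , e
plug-split (nrecE r s F) (nrecE r' s' A) c u eq with nrec-injective eq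
... | refl , refl , eqA with plug-split F A c u eqA
...   | H , refl , e = H , refl , e
plug-split (_ ·E _)      □             c u ()
plug-split (_ ·E _)      (SE _)        c u ()
plug-split (_ ·E _)      (nrecE _ _ _) c u ()
plug-split (SE _)        □             c u ()
plug-split (SE _)        (_ ·E _)      c u ()
plug-split (SE _)        (nrecE _ _ _) c u ()
plug-split (nrecE _ _ _) □             c u ()
plug-split (nrecE _ _ _) (_ ·E _)      c u ()
plug-split (nrecE _ _ _) (SE _)        c u ()

-- One-layer inversion of ⇒: the possible reducts of each term former.  Each
-- lemma takes the source up to an equation so that the relevant rules can
-- be matched on.
inv-var : ∀ {x v} → x ⇒ v → ∀ {y} → x ≡ ` y → v ≡ ` y
inv-var t1 refl = refl
inv-var (t4 (sing-app u) d e) ()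
inv-var (t4 sing-S d e) ()
inv-var (t4 (sing-nrec r s) d e) ()
inv-var (t6 {E = E} d e) eq = ⊥-elim (not-headμ eq refl)
inv-var (t8 d) ()
inv-var (t9 d d₁) ()

inv-zero : ∀ {x v} → x ⇒ v → x ≡ 𝟘 → v ≡ 𝟘
inv-zero t2 refl = refl
inv-zero (t4 (sing-app u) d e) ()
inv-zero (t4 sing-S d e) ()
inv-zero (t4 (sing-nrec r s) d e) ()
inv-zero (t6 {E = E} d e) eq = ⊥-elim (not-headμ eq refl)
inv-zero (t8 d) ()
inv-zero (t9 d d₁) ()

inv-lam : ∀ {x v} → x ⇒ v → ∀ {b} → x ≡ ƛ b → Σ Tm λ b' → (v ≡ ƛ b') × (b ⇒ b')
inv-lam (t3 d) refl = _ , refl , d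
inv-lam (t4 (sing-app u) d e) ()
inv-lam (t4 sing-S d e) ()
inv-lam (t4 (sing-nrec r s) d e) ()
inv-lam (t6 {E = E} d e) eq = ⊥-elim (not-headμ eq refl)
inv-lam (t8 d) ()
inv-lam (t9 d d₁) ()

data AppView (t u : Tm) : Tm → Set where
  a-cong : ∀ {t' u'} → t ⇒ t' → u ⇒ u' → AppView t u (t' · u')
  a-beta : ∀ {b b' u'} → t ≡ ƛ b → b ⇒ b' → u ⇒ u' → AppView t u (b' [0:= u' ])
  a-mu : ∀ {E E' c c' u'} → t ≡ plug E (μ c) → c ⇒c c' → E ⇒E E' → u ⇒ u' →
         AppView t u (μ ssubc (sself (E' ·E u')) c')

inv-app : ∀ {x v} → x ⇒ v → ∀ {t u} → x ≡ t · u → AppView t u v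
inv-app (t4 (sing-app u) d (E2 E1 e)) refl = a-cong d e
inv-app (t4 sing-S d e) ()
inv-app (t4 (sing-nrec r s) d e) ()
inv-app (t5 d e) refl = a-beta refl d e
inv-app (t6 {E = □} d e) ()
inv-app (t6 {E = E ·E u} d (E2 e e')) refl = a-mu refl d e e'
inv-app (t6 {E = SE E} d e) ()
inv-app (t6 {E = nrecE r s E} d e) ()
inv-app (t8 d) ()
inv-app (t9 d d₁) ()

data SView (t : Tm) : Tm → Set where
  s-cong : ∀ {t'} → t ⇒ t' → SView t (S t')
  s-mu : ∀ {E E' c c'} → t ≡ plug E (μ c) → c ⇒c c' → E ⇒E E' → SView t (μ ssubc (sself (SE E')) c')

inv-S : ∀ {x v} → x ⇒ v → ∀ {t} → x ≡ S t → SView t v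
inv-S (t4 (sing-app u) d e) ()
inv-S (t4 sing-S d (E3 E1)) refl = s-cong d
inv-S (t4 (sing-nrec r s) d e) ()
inv-S (t6 {E = □} d e) ()
inv-S (t6 {E = E ·E u} d e) ()
inv-S (t6 {E = SE E} d (E3 e)) refl = s-mu refl d e
inv-S (t6 {E = nrecE r s E} d e) ()
inv-S (t8 d) ()
inv-S (t9 d d₁) ()

data NrecView (r s t : Tm) : Tm → Set where
  n-cong : ∀ {r' s' t'} → r ⇒ r' → s ⇒ s' → t ⇒ t' → NrecView r s t (nrec r' s' t')
  n-zero : ∀ {r'} → t ≡ 𝟘 → r ⇒ r' → NrecView r s t r'
  n-suc : ∀ {r' s' n} → t ≡ S num n → r ⇒ r' → s ⇒ s' → NrecView r s t (s' · num n · nrec r' s' (num n))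
  n-mu : ∀ {E E' c c' r' s'} → t ≡ plug E (μ c) → c ⇒c c' → E ⇒E E' → r ⇒ r' → s ⇒ s' →
         NrecView r s t (μ ssubc (sself (nrecE r' s' E')) c')

inv-nrec : ∀ {x v} → x ⇒ v → ∀ {r s t} → x ≡ nrec r s t → NrecView r s t v
inv-nrec (t4 (sing-app u) d e) ()
inv-nrec (t4 sing-S d e) ()
inv-nrec (t4 (sing-nrec r s) d (E4 E1 a b)) refl = n-cong a b d
inv-nrec (t6 {E = □} d e) ()
inv-nrec (t6 {E = E ·E u} d e) ()
inv-nrec (t6 {E = SE E} d e) ()
inv-nrec (t6 {E = nrecE r s E} d (E4 e a b)) refl = n-mu refl d e a b
inv-nrec (t8 d) refl = n-zero refl d
inv-nrec (t9 d e) refl = n-suc refl d e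

data MuView (c : Cmd) : Tm → Set where
  m-cong : ∀ {c'} → c ⇒c c' → MuView c (μ ssubc (sself □) c')
  m-t7 : ∀ {u v} → c ≡ [ zero ] renμ suc u → u ⇒ v → MuView c v

inv-mu : ∀ {x v} → x ⇒ v → ∀ {c} → x ≡ μ c → MuView c v
inv-mu (t4 (sing-app u) d e) ()
inv-mu (t4 sing-S d e) ()
inv-mu (t4 (sing-nrec r s) d e) ()
inv-mu (t6 {E = □} d E1) refl = m-cong d
inv-mu (t6 {E = E ·E u} d e) ()
inv-mu (t6 {E = SE E} d e) ()
inv-mu (t6 {E = nrecE r s E} d e) ()
inv-mu (t7 d) refl = m-t7 refl d
inv-mu (t8 d) ()
inv-mu (t9 d d₁) ()

data CmdView (α : ℕ) (t : Tm) : Cmd → Set where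
  cmd-c1 : ∀ {t'} → t ⇒ t' → CmdView α t ([ α ] t')
  cmd-c2 : ∀ {E E' d d'} → t ≡ plug E (μ d) → d ⇒c d' → E ⇒E E' → CmdView α t (ssubc (sout α E') d')

inv-cmd : ∀ {α t c'} → [ α ] t ⇒c c' → CmdView α t c'
inv-cmd (c1 d) = cmd-c1 d
inv-cmd (c2 d e) = cmd-c2 refl d e

inv-num : ∀ n {v} → num n ⇒ v → v ≡ num n
inv-num zero d = inv-zero d refl
inv-num (suc n) d with inv-S d refl
... | s-cong d' = cong S_ (inv-num n d')
... | s-mu eq _ _ = ⊥-elim (not-headμ (sym eq) (headμ-num n))

-- A reduct of E[μc] is obtained either by a t6 step at some
-- splitting E = Ea ∘ Eb of the spine (Eb is absorbed into the command, Ea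
-- is reduced in place), or, when c = [α](u↑), by a t7 step erasing the
-- binder.
data SpineView (E : Ctx) (c : Cmd) : Tm → Set where
  spine-t6 : ∀ Ea Eb {Ea' Eb' c'} → E ≡ compose Ea Eb → Ea ⇒E Ea' → Eb ⇒E Eb' → c ⇒c c' →
             SpineView E c (plug Ea' (μ ssubc (sself Eb') c'))
  spine-t7 : ∀ {u E' w} → c ≡ [ zero ] renμ suc u → E ⇒E E' → u ⇒ w → SpineView E c (plug E' w)

spine : ∀ E c {v} → plug E (μ c) ⇒ v → SpineView E c v
spine □ c d with inv-mu d refl
... | m-cong dc = spine-t6 □ □ refl E1 E1 dc
... | m-t7 eq dw = spine-t7 eq E1 dw
spine (E ·E u) c d with inv-app d refl
... | a-cong d1 du with spine E c d1
...   | spine-t6 Ea Eb eq ea eb dc = spine-t6 (Ea ·E u) Eb (cong (_·E u) eq) (E2 ea du) eb dc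
...   | spine-t7 eq e dw = spine-t7 eq (E2 e du) dw
spine (E ·E u) c d | a-beta eq _ _ = ⊥-elim (not-headμ eq refl)
spine (E ·E u) c d | a-mu {E0} eq dc e du with plugμ-injective E E0 c _ eq
... | refl , refl = spine-t6 □ (E ·E u) refl E1 (E2 e du) dc
spine (SE E) c d with inv-S d refl
... | s-cong d1 with spine E c d1
...   | spine-t6 Ea Eb eq ea eb dc = spine-t6 (SE Ea) Eb (cong SE eq) (E3 ea) eb dc
...   | spine-t7 eq e dw = spine-t7 eq (E3 e) dw
spine (SE E) c d | s-mu {E0} eq dc e with plugμ-injective E E0 c _ eq
... | refl , refl = spine-t6 □ (SE E) refl E1 (E3 e) dc
spine (nrecE r s E) c d with inv-nrec d refl
... | n-cong dr ds d1 with spine E c d1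
...   | spine-t6 Ea Eb eq ea eb dc = spine-t6 (nrecE r s Ea) Eb (cong (nrecE r s) eq) (E4 ea dr ds) eb dc
...   | spine-t7 eq e dw = spine-t7 eq (E4 e dr ds) dw
spine (nrecE r s E) c d | n-zero eq _ = ⊥-elim (not-headμ eq refl)
spine (nrecE r s E) c d | n-suc {n = n} eq _ _ = ⊥-elim (not-headμ eq (headμ-num n))
spine (nrecE r s E) c d | n-mu {E0} eq dc e dr ds with plugμ-injective E E0 c _ eq
... | refl , refl = spine-t6 □ (nrecE r s E) refl E1 (E4 e dr ds) dc

renμ-inv-var : ∀ g u {x} → renμ g u ≡ ` x → u ≡ ` x
renμ-inv-var g (` y) refl = refl
renμ-inv-var g (ƛ u) ()
renμ-inv-var g (u · u₁) ()
renμ-inv-var g (μ x) ()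
renμ-inv-var g 𝟘 ()
renμ-inv-var g (S u) ()
renμ-inv-var g (nrec u u₁ u₂) ()

renμ-inv-zero : ∀ g u → renμ g u ≡ 𝟘 → u ≡ 𝟘
renμ-inv-zero g (` y) ()
renμ-inv-zero g (ƛ u) ()
renμ-inv-zero g (u · u₁) ()
renμ-inv-zero g (μ x) ()
renμ-inv-zero g 𝟘 refl = refl
renμ-inv-zero g (S u) ()
renμ-inv-zero g (nrec u u₁ u₂) ()

renμ-inv-lam : ∀ g u {b} → renμ g u ≡ ƛ b → Σ Tm λ u0 → (u ≡ ƛ u0) × (renμ g u0 ≡ b)
renμ-inv-lam g (` y) ()
renμ-inv-lam g (ƛ u) refl = u , refl , refl
renμ-inv-lam g (u · u₁) ()
renμ-inv-lam g (μ x) ()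
renμ-inv-lam g 𝟘 ()
renμ-inv-lam g (S u) ()
renμ-inv-lam g (nrec u u₁ u₂) ()

renμ-inv-S : ∀ g u {b} → renμ g u ≡ S b → Σ Tm λ u0 → (u ≡ S u0) × (renμ g u0 ≡ b)
renμ-inv-S g (` y) ()
renμ-inv-S g (ƛ u) ()
renμ-inv-S g (u · u₁) ()
renμ-inv-S g (μ x) ()
renμ-inv-S g 𝟘 ()
renμ-inv-S g (S u) refl = u , refl , refl
renμ-inv-S g (nrec u u₁ u₂) ()

renμ-inv-app : ∀ g u {a b} → renμ g u ≡ a · b →
               Σ Tm λ u1 → Σ Tm λ u2 → (u ≡ u1 · u2) × (renμ g u1 ≡ a) × (renμ g u2 ≡ b)
renμ-inv-app g (` y) ()
renμ-inv-app g (ƛ u) ()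
renμ-inv-app g (u · u₁) refl = u , u₁ , refl , refl , refl
renμ-inv-app g (μ x) ()
renμ-inv-app g 𝟘 ()
renμ-inv-app g (S u) ()
renμ-inv-app g (nrec u u₁ u₂) ()

renμ-inv-nrec : ∀ g u {a b d} → renμ g u ≡ nrec a b d →
          Σ Tm λ u1 → Σ Tm λ u2 → Σ Tm λ u3 →
          (u ≡ nrec u1 u2 u3) × (renμ g u1 ≡ a) × (renμ g u2 ≡ b) × (renμ g u3 ≡ d)
renμ-inv-nrec g (` y) ()
renμ-inv-nrec g (ƛ u) ()
renμ-inv-nrec g (u · u₁) ()
renμ-inv-nrec g (μ x) ()
renμ-inv-nrec g 𝟘 ()
renμ-inv-nrec g (S u) ()
renμ-inv-nrec g (nrec u u₁ u₂) refl = u , u₁ , u₂ , refl , refl , refl , refl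

renμ-inv-mu : ∀ g u {c} → renμ g u ≡ μ c → Σ Cmd λ c0 → (u ≡ μ c0) × (renμc (ext g) c0 ≡ c)
renμ-inv-mu g (` y) ()
renμ-inv-mu g (ƛ u) ()
renμ-inv-mu g (u · u₁) ()
renμ-inv-mu g (μ x) refl = x , refl , refl
renμ-inv-mu g 𝟘 ()
renμ-inv-mu g (S u) ()
renμ-inv-mu g (nrec u u₁ u₂) ()

renμ-inv-num : ∀ g u n → renμ g u ≡ num n → u ≡ num n
renμ-inv-num g u zero eq = renμ-inv-zero g u eq
renμ-inv-num g u (suc n) eq with renμ-inv-S g u eq
... | u0 , refl , e = cong S_ (renμ-inv-num g u0 n e)

-- If two renamings f, g admit a "pullback" (h, k), then any
-- term in the image of both renμ f and renμ g comes from a common term.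
-- Its main instance: a term that is both a weakening and a renaming ext ρ
-- of something is a weakening of a ρ-renaming.
Pullback : (f g h k : ℕ → ℕ) → Set
Pullback f g h k = ∀ a b → f a ≡ g b → Σ ℕ λ c → (a ≡ h c) × (b ≡ k c)

pullback-ext : ∀ {f g h k} → Pullback f g h k → Pullback (ext f) (ext g) (ext h) (ext k)
pullback-ext p zero zero eq = zero , refl , refl
pullback-ext p zero (suc b) ()
pullback-ext p (suc a) zero ()
pullback-ext p (suc a) (suc b) eq with p a b (suc-injective eq)
... | c , refl , refl = suc c , refl , refl

mutual
  strengthen : ∀ {f g h k} → Pullback f g h k → ∀ t u → renμ f t ≡ renμ g u →
               Σ Tm λ v → (t ≡ renμ h v) × (u ≡ renμ k v)
  strengthen {g = g} p (` x) u eq = ` x , refl , renμ-inv-var g u (sym eq)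
  strengthen {g = g} p (ƛ t) u eq with renμ-inv-lam g u (sym eq)
  ... | u0 , refl , e with strengthen p t u0 (sym e)
  ...   | v , refl , refl = ƛ v , refl , refl
  strengthen {g = g} p (t · t') u eq with renμ-inv-app g u (sym eq)
  ... | u1 , u2 , refl , e1 , e2 with strengthen p t u1 (sym e1) | strengthen p t' u2 (sym e2)
  ...   | v , refl , refl | v' , refl , refl = v · v' , refl , refl
  strengthen {g = g} p (μ c) u eq with renμ-inv-mu g u (sym eq)
  ... | c0 , refl , e with strengthenc (pullback-ext p) c c0 (sym e)
  ...   | v , refl , refl = μ v , refl , refl
  strengthen {g = g} p 𝟘 u eq = 𝟘 , refl , renμ-inv-zero g u (sym eq)
  strengthen {g = g} p (S t) u eq with renμ-inv-S g u (sym eq)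
  ... | u0 , refl , e with strengthen p t u0 (sym e)
  ...   | v , refl , refl = S v , refl , refl
  strengthen {g = g} p (nrec a b t) u eq with renμ-inv-nrec g u (sym eq)
  ... | u1 , u2 , u3 , refl , e1 , e2 , e3
    with strengthen p a u1 (sym e1) | strengthen p b u2 (sym e2) | strengthen p t u3 (sym e3)
  ...   | v1 , refl , refl | v2 , refl , refl | v3 , refl , refl = nrec v1 v2 v3 , refl , refl

  strengthenc : ∀ {f g h k} → Pullback f g h k → ∀ c c' → renμc f c ≡ renμc g c' →
               Σ Cmd λ v → (c ≡ renμc h v) × (c' ≡ renμc k v)
  strengthenc p ([ a ] t) ([ b ] u) eq with p a b (proj₁ (cmd-injective eq))
                                                  | strengthen p t u (proj₂ (cmd-injective eq))
  ... | c , refl , refl | v , refl , refl = [ c ] v , refl , refl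

pullback-wk : ∀ ρ → Pullback (ext ρ) suc suc ρ
pullback-wk ρ zero b ()
pullback-wk ρ (suc a) b eq = a , refl , suc-injective (sym eq)

renμ-inv-plug : ∀ ρ t E c → renμ ρ t ≡ plug E (μ c) →
          Σ Ctx λ E0 → Σ Cmd λ c0 → (t ≡ plug E0 (μ c0)) × (renμE ρ E0 ≡ E) × (renμc (ext ρ) c0 ≡ c)
renμ-inv-plug ρ t □ c eq with renμ-inv-mu ρ t eq
... | c0 , refl , e = □ , c0 , refl , refl , e
renμ-inv-plug ρ t (E ·E u) c eq with renμ-inv-app ρ t eq
... | u1 , u2 , refl , e1 , refl with renμ-inv-plug ρ u1 E c e1
...   | E0 , c0 , refl , refl , e = (E0 ·E u2) , c0 , refl , refl , e
renμ-inv-plug ρ t (SE E) c eq with renμ-inv-S ρ t eq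
... | u1 , refl , e1 with renμ-inv-plug ρ u1 E c e1
...   | E0 , c0 , refl , refl , e = SE E0 , c0 , refl , refl , e
renμ-inv-plug ρ t (nrecE r s E) c eq with renμ-inv-nrec ρ t eq
... | u1 , u2 , u3 , refl , refl , refl , e3 with renμ-inv-plug ρ u3 E c e3
...   | E0 , c0 , refl , refl , e = nrecE u1 u2 E0 , c0 , refl , refl , e

mutual
  antiren : ∀ {x v} → x ⇒ v → ∀ ρ t → x ≡ renμ ρ t → Σ Tm λ w → (v ≡ renμ ρ w) × (t ⇒ w)
  antiren t1 ρ t eq with renμ-inv-var ρ t (sym eq)
  ... | refl = ` _ , refl , t1
  antiren t2 ρ t eq with renμ-inv-zero ρ t (sym eq)
  ... | refl = 𝟘 , refl , t2
  antiren (t3 d) ρ t eq with renμ-inv-lam ρ t (sym eq)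
  ... | b0 , refl , e with antiren d ρ b0 (sym e)
  ...   | w , refl , dw = ƛ w , refl , t3 dw
  antiren (t4 (sing-app u) d (E2 E1 e)) ρ t eq with renμ-inv-app ρ t (sym eq)
  ... | a , b , refl , ea , eb with antiren d ρ a (sym ea) | antiren e ρ b (sym eb)
  ...   | w , refl , dw | w' , refl , dw' = w · w' , refl , app⇒ dw dw'
  antiren (t4 sing-S d (E3 E1)) ρ t eq with renμ-inv-S ρ t (sym eq)
  ... | a , refl , ea with antiren d ρ a (sym ea)
  ...   | w , refl , dw = S w , refl , S⇒ dw
  antiren (t4 (sing-nrec r s) d (E4 E1 dr ds)) ρ t eq with renμ-inv-nrec ρ t (sym eq)
  ... | a , b , c , refl , ea , eb , ec
    with antiren dr ρ a (sym ea) | antiren ds ρ b (sym eb) | antiren d ρ c (sym ec)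
  ...   | w1 , refl , d1 | w2 , refl , d2 | w3 , refl , d3 = nrec w1 w2 w3 , refl , nrec⇒ d1 d2 d3
  antiren (t5 d e) ρ t eq with renμ-inv-app ρ t (sym eq)
  ... | a , b , refl , ea , eb with renμ-inv-lam ρ a ea
  ...   | a0 , refl , ea0 with antiren d ρ a0 (sym ea0) | antiren e ρ b (sym eb)
  ...     | w1 , refl , d1 | w2 , refl , d2 = w1 [0:= w2 ] , sym (renμ-inst ρ w1 w2) , t5 d1 d2
  antiren (t6 {c} {E = E} d e) ρ t eq with renμ-inv-plug ρ t E c (sym eq)
  ... | E0 , c0 , refl , eE , ec with antirenc d (ext ρ) c0 (sym ec) | antirenE e ρ E0 (sym eE)
  ...   | d0 , refl , dd | F0 , refl , de = μ ssubc (sself F0) d0 , cong μ_ (sym (renμ-sself ρ F0 d0)) , t6 dd de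
  antiren (t7 {u} d) ρ t eq with renμ-inv-mu ρ t (sym eq)
  ... | [ zero ] t0 , refl , e with strengthen (pullback-wk ρ) t0 u (proj₂ (cmd-injective e))
  ...   | v , refl , refl with antiren d ρ v refl
  ...     | w , refl , dw = w , refl , t7 dw
  antiren (t7 {u} d) ρ t eq | [ suc k ] t0 , refl , ()
  antiren (t8 d) ρ t eq with renμ-inv-nrec ρ t (sym eq)
  ... | a , b , c , refl , ea , eb , ec with renμ-inv-zero ρ c ec | antiren d ρ a (sym ea)
  ...   | refl | w , refl , dw = w , refl , t8 dw
  antiren (t9 {n = n} d e) ρ t eq with renμ-inv-nrec ρ t (sym eq)
  ... | a , b , c , refl , ea , eb , ec
    with renμ-inv-num ρ c (suc n) ec | antiren d ρ a (sym ea) | antiren e ρ b (sym eb)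
  ...   | refl | w1 , refl , d1 | w2 , refl , d2 =
    w2 · num n · nrec w1 w2 (num n) ,
    cong (λ z → renμ ρ w2 · z · nrec (renμ ρ w1) (renμ ρ w2) z) (sym (num-renμ ρ n)) , t9 d1 d2

  antirenc : ∀ {x v} → x ⇒c v → ∀ ρ c → x ≡ renμc ρ c → Σ Cmd λ w → (v ≡ renμc ρ w) × (c ⇒c w)
  antirenc (c1 d) ρ ([ a ] t0) refl with antiren d ρ t0 refl
  ... | w , refl , dw = [ a ] w , refl , c1 dw
  antirenc (c2 {α} {c} {c'} {E} {E'} d e) ρ ([ a ] t0) eq
    with proj₁ (cmd-injective eq) | renμ-inv-plug ρ t0 E c (sym (proj₂ (cmd-injective eq)))
  ... | refl | E0 , c0 , refl , eE , ec with antirenc d (ext ρ) c0 (sym ec) | antirenE e ρ E0 (sym eE)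
  ...   | d0 , refl , dd | F0 , refl , de = ssubc (sout a F0) d0 , sym (renμ-sout ρ a F0 d0) , c2 dd de

  antirenE : ∀ {x v} → x ⇒E v → ∀ ρ E → x ≡ renμE ρ E → Σ Ctx λ W → (v ≡ renμE ρ W) × (E ⇒E W)
  antirenE E1 ρ □ refl = □ , refl , E1
  antirenE (E2 e d) ρ (E ·E u) refl with antirenE e ρ E refl | antiren d ρ u refl
  ... | W , refl , dW | w , refl , dw = (W ·E w) , refl , E2 dW dw
  antirenE (E3 e) ρ (SE E) refl with antirenE e ρ E refl
  ... | W , refl , dW = SE W , refl , E3 dW
  antirenE (E4 e dr ds) ρ (nrecE r s E) refl with antirenE e ρ E refl | antiren dr ρ r refl | antiren ds ρ s refl
  ... | W , refl , dW | w1 , refl , d1 | w2 , refl , d2 = nrecE w1 w2 W , refl , E4 dW d1 d2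

-- For contexts the property is required
-- componentwise, which is what makes it compatible with splitting contexts.
Tri : Tm → Tm → Set
Tri t t* = ∀ {v} → t ⇒ v → v ⇒ t*

TriC : Cmd → Cmd → Set
TriC c c* = ∀ {v} → c ⇒c v → v ⇒c c*

data TriE : Ctx → Ctx → Set where
  te□ : TriE □ □
  te· : ∀ {E E* u u*} → TriE E E* → Tri u u* → TriE (E ·E u) (E* ·E u*)
  teS : ∀ {E E*} → TriE E E* → TriE (SE E) (SE E*)
  ten : ∀ {E E* r r* s s*} → TriE E E* → Tri r r* → Tri s s* → TriE (nrecE r s E) (nrecE r* s* E*)

triE : ∀ {E E*} → TriE E E* → ∀ {E'} → E ⇒E E' → E' ⇒E E*
triE te□ E1 = E1
triE (te· T Tu) (E2 e d) = E2 (triE T e) (Tu d)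
triE (teS T) (E3 e) = E3 (triE T e)
triE (ten T Tr Ts) (E4 e dr ds) = E4 (triE T e) (Tr dr) (Ts ds)

triE-split : ∀ A B {F*} → TriE (compose A B) F* →
             Σ Ctx λ A* → Σ Ctx λ B* → (F* ≡ compose A* B*) × TriE A A* × TriE B B*
triE-split □ B T = □ , _ , refl , te□ , T
triE-split (A ·E u) B (te· T Tu) with triE-split A B T
... | A* , B* , refl , TA , TB = (A* ·E _) , B* , refl , te· TA Tu , TB
triE-split (SE A) B (teS T) with triE-split A B T
... | A* , B* , refl , TA , TB = SE A* , B* , refl , teS TA , TB
triE-split (nrecE r s A) B (ten T Tr Ts) with triE-split A B T
... | A* , B* , refl , TA , TB = nrecE _ _ A* , B* , refl , ten TA Tr Ts , TB

triT-ren : ∀ ρ {t t*} → Tri t t* → Tri (renμ ρ t) (renμ ρ t*)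
triT-ren ρ {t} T d with antiren d ρ t refl
... | w , refl , dw = ⇒-renμ ρ (T dw)

triC-ren : ∀ ρ {c c*} → TriC c c* → TriC (renμc ρ c) (renμc ρ c*)
triC-ren ρ {c} T d with antirenc d ρ c refl
... | w , refl , dw = ⇒c-renμ ρ (T dw)

triE-ren : ∀ ρ {E E*} → TriE E E* → TriE (renμE ρ E) (renμE ρ E*)
triE-ren ρ te□ = te□
triE-ren ρ (te· T Tu) = te· (triE-ren ρ T) (triT-ren ρ Tu)
triE-ren ρ (teS T) = teS (triE-ren ρ T)
triE-ren ρ (ten T Tr Ts) = ten (triE-ren ρ T) (triT-ren ρ Tr) (triT-ren ρ Ts)

NotT7 : Cmd → Set
NotT7 d = ∀ u → ¬ (d ≡ [ zero ] renμ suc u)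

notT7-ren : ∀ ρ {d} → NotT7 d → NotT7 (renμc (ext ρ) d)
notT7-ren ρ {[ zero ] t0} nt u eq with strengthen (pullback-wk ρ) t0 u (proj₂ (cmd-injective eq))
... | v , refl , refl = nt v refl
notT7-ren ρ {[ suc k ] t0} nt u ()

wk-inj : ∀ {a b} → renμ suc a ≡ renμ suc b → a ≡ b
wk-inj {a} {b} eq = begin
  a                      ≡⟨ sym (unweaken a) ⟩
  renμ pred (renμ suc a) ≡⟨ cong (renμ pred) eq ⟩
  renμ pred (renμ suc b) ≡⟨ unweaken b ⟩
  b                      ∎
  where open ≡-Reasoning
        unweaken : ∀ t → renμ pred (renμ suc t) ≡ t
        unweaken t = trans (renμ-fuse (λ _ → refl) t) (renμ-id (λ _ → refl) t)

sself⇒ : ∀ {E E'} → E ⇒E E' → SSubR (sself E) (sself E')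
sself⇒ e zero = refl , ⇒E-renμ suc e
sself⇒ e (suc n) = refl , E1

sout⇒ : ∀ α {E E'} → E ⇒E E' → SSubR (sout α E) (sout α E')
sout⇒ α e zero = refl , e
sout⇒ α e (suc n) = refl , E1

-- Sk cc n G Z says that Z consists of n nested t7-redexes
-- A[μα.[α](Z'↑)] sitting on the spine, ending in a core F[μ cc], where G is
-- the composite of all spine contexts A, ..., F.  Erasing all n binders by
-- t7 turns Z into G[μ cc]; this is how a complete development sees Z.
data Sk (cc : Cmd) : ℕ → Ctx → Tm → Set where
  sk0 : ∀ {F} → Sk cc zero F (plug F (μ cc))
  sk+ : ∀ A {n G Z} → Sk cc n G Z → Sk cc (suc n) (compose A G) (plug A (μ ([ zero ] renμ suc Z)))

sk-cast : ∀ {cc n G G' Z Z'} → G ≡ G' → Z ≡ Z' → Sk cc n G Z → Sk cc n G' Z'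
sk-cast refl refl s = s

sk-plug : ∀ {cc n G Z} → Sk cc n G Z → ∀ A → Sk cc n (compose A G) (plug A Z)
sk-plug (sk0 {F}) A = sk-cast refl (plug-compose A F _) sk0
sk-plug (sk+ A' {G = G} s) A = sk-cast (compose-assoc A A' G) (plug-compose A A' _) (sk+ (compose A A') s)

sk-ren : ∀ ρ {cc n G Z} → Sk cc n G Z → Sk (renμc (ext ρ) cc) n (renμE ρ G) (renμ ρ Z)
sk-ren ρ {cc} (sk0 {F}) = sk-cast refl (sym (renμ-plug ρ F (μ cc))) sk0
sk-ren ρ (sk+ A {G = G} {Z = Z} s) =
  sk-cast (sym (renμE-compose ρ A G))
          (trans (cong (λ z → plug (renμE ρ A) (μ ([ zero ] z))) (sym (renμ-wkfuse ρ Z)))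
                 (sym (renμ-plug ρ A _)))
          (sk+ (renμE ρ A) (sk-ren ρ s))

sk-peel : ∀ {cc n G X} → Sk cc n G X → ∀ F u → X ≡ plug F u →
          Σ Ctx λ H → (G ≡ compose F H) × Sk cc n H u
sk-peel {cc} (sk0 {G}) F u eq with plug-split F G cc u eq
... | H , refl , refl = H , refl , sk0
sk-peel (sk+ A {G = G2} s) F u eq with plug-split F A _ u eq
... | H , refl , refl = compose H G2 , compose-assoc F H G2 , sk+ H s

data WrapView (Z2 : Tm) (c' : Cmd) : Set where
  wrap-body : ∀ {w} → Z2 ⇒ w → c' ≡ [ zero ] renμ suc w → WrapView Z2 c'
  wrap-c2   : ∀ {H0 H0' e0 e0'} → Z2 ≡ plug H0 (μ e0) → H0 ⇒E H0' → e0 ⇒c e0' →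
              c' ≡ ssubc (sself H0') e0' → WrapView Z2 c'

wrap-view : ∀ {Z2 c'} → [ zero ] renμ suc Z2 ⇒c c' → WrapView Z2 c'
wrap-view {Z2} d with inv-cmd d
... | cmd-c1 dx with antiren dx suc Z2 refl
...   | w , refl , dw = wrap-body dw refl
wrap-view {Z2} d | cmd-c2 {E} {d = e} eq dd de with renμ-inv-plug suc Z2 E e eq
... | H0 , e0 , refl , eH , ec with antirenc dd (ext suc) e0 (sym ec) | antirenE de suc H0 (sym eH)
...   | e0' , refl , de0 | H0' , refl , dH0 = wrap-c2 refl dH0 de0 (sout-lift H0' e0')

t6-fused : ∀ {Aa Aa' Ab Ab' H0 H0' e0 e0'} → Aa ⇒E Aa' → Ab ⇒E Ab' → H0 ⇒E H0' → e0 ⇒c e0' →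
           plug (compose Aa Ab) (plug H0 (μ e0)) ⇒
           plug Aa' (μ ssubc (sself Ab') (ssubc (sself H0') e0'))
t6-fused {Aa} {Aa'} {Ab} {Ab'} {H0} {H0'} {e0' = e0'} ea eb dH de =
  ⇒-cast (trans (cong (plug Aa) (plug-compose Ab H0 _)) (sym (plug-compose Aa Ab _)))
         (cong (λ x → plug Aa' (μ x)) (sym (sself-fuse Ab' H0' e0')))
         (plug⇒ ea (t6 de (compose⇒ eb dH)))

-- Either the
-- reduct is already a reduct of a skeleton with one wrapper less (the
-- wrapper was erased by t7, or a c2 step inside it merged the inner spine
-- into the outer one), or the wrapper survives: a t6 step at a splitting
-- A = Aa ∘ Ab moved Ab into it and Z was reduced.
data SkStep (cc : Cmd) (m : ℕ) (G : Ctx) : Tm → Set where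
  sk-smaller : ∀ {Z Y} → Sk cc m G Z → Z ⇒ Y → SkStep cc m G Y
  sk-kept    : ∀ Aa Ab {Aa' Ab' G2 Z w} → G ≡ compose Aa (compose Ab G2) → Sk cc m G2 Z →
               Aa ⇒E Aa' → Ab ⇒E Ab' → Z ⇒ w →
               SkStep cc m G (plug Aa' (μ ssubc (sself Ab') ([ zero ] renμ suc w)))

sk-step : ∀ {cc m G Z Y} → Sk cc (suc m) G Z → Z ⇒ Y → SkStep cc m G Y
sk-step (sk+ A {Z = Z} s) dY with spine A ([ zero ] renμ suc Z) dY
... | spine-t7 eq eA dw with wk-inj (proj₂ (cmd-injective eq))
...   | refl = sk-smaller (sk-plug s A) (plug⇒ eA dw)
sk-step (sk+ A {G = G2} s) dY | spine-t6 Aa Ab refl ea eb dc with wrap-view dc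
... | wrap-body dw refl        = sk-kept Aa Ab (compose-assoc Aa Ab G2) s ea eb dw
... | wrap-c2 refl dH de refl = sk-smaller (sk-plug s (compose Aa Ab)) (t6-fused ea eb dH de)

sk-cmd-step : ∀ {cc m G Z E E' e e'} → Sk cc (suc m) G Z → Z ≡ plug E (μ e) → e ⇒c e' → E ⇒E E' →
              ∀ α → Σ Tm λ Z' → Sk cc m G Z' × ([ α ] Z' ⇒c ssubc (sout α E') e')
sk-cmd-step {E = E} {E'} (sk+ A {Z = Z} s) eq dd de α with plugμ-injective A E _ _ eq
... | refl , refl with wrap-view dd
...   | wrap-body {w} dw refl =
  plug A Z , sk-plug s A ,
  ⇒c-cast refl (cong ([ α ]_) (cong (plug E') (sym (sout-wk α E' w)))) (c1 (plug⇒ de dw))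
...   | wrap-c2 {H0} {H0'} {e0} {e0'} refl dH de0 refl =
  plug A (plug H0 (μ e0)) , sk-plug s A ,
  ⇒c-cast (cong ([ α ]_) (plug-compose A H0 (μ e0))) (sym (sout-sself-fuse α E' H0' e0'))
          (c2 de0 (compose⇒ de dH))

-- All proofs are by induction on the number of wrappers:
-- sk-step reduces to fewer wrappers unless the outer wrapper survives, in
-- which case its body is handled by the induction hypothesis under the
-- binder (triSkelμ-wrapped).
mutual
  triSkelμ-under : ∀ n {d d* G G* Z} → Sk d n G Z → NotT7 d → TriC d d* → TriE G G* →
                   ∀ {W} → Z ⇒ W → ∀ α → [ α ] W ⇒c ssubc (sout α G*) d*
  triSkelμ-under zero {d} {d*} (sk0 {G}) nt Td TG dW α with spine G d dW
  ... | spine-t7 eq _ _ = ⊥-elim (nt _ eq)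
  ... | spine-t6 Ea Eb refl ea eb dc with triE-split Ea Eb TG
  ...   | Ea* , Eb* , refl , TA , TB =
    ⇒c-cast refl (sout-sself-fuse α Ea* Eb* d*) (c2 (⇒c-ssub (sself⇒ (triE TB eb)) (Td dc)) (triE TA ea))
  triSkelμ-under (suc m) {d* = d*} s nt Td TG dW α with sk-step s dW
  ... | sk-smaller s' dW' = triSkelμ-under m s' nt Td TG dW' α
  ... | sk-kept Aa Ab refl s' ea eb dw with triE-split Aa _ TG
  ...   | Aa* , R* , refl , TAa , TR =
    ⇒c-cast refl (sout-sself-fuse α Aa* R* d*) (c2 (triSkelμ-wrapped m s' nt Td TR eb dw) (triE TAa ea))

  triSkelμ-wrapped : ∀ m {d d* Ab Ab' G2 R* Z w} → Sk d m G2 Z → NotT7 d → TriC d d* →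
                     TriE (compose Ab G2) R* → Ab ⇒E Ab' → Z ⇒ w →
                     ssubc (sself Ab') ([ zero ] renμ suc w) ⇒c ssubc (sself R*) d*
  triSkelμ-wrapped m {d* = d*} {Ab} {Ab'} {R* = R*} {w = w} s nt Td TR eb dw =
    ⇒c-cast (sym (sself-wrap Ab' w)) (sout-lift R* d*)
      (triSkelμ-under m (sk-ren suc (sk-plug s Ab)) (notT7-ren suc nt) (triC-ren (ext suc) Td)
                      (triE-ren suc TR) (⇒-renμ suc (plug⇒ eb dw)) zero)

triSkelμ : ∀ n {d d* G G* Z} → Sk d n G Z → NotT7 d → TriC d d* → TriE G G* →
           ∀ {Y} → Z ⇒ Y → Y ⇒ μ ssubc (sself G*) d*
triSkelμ zero {d} {d*} (sk0 {G}) nt Td TG dY with spine G d dY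
... | spine-t7 eq _ _ = ⊥-elim (nt _ eq)
... | spine-t6 Ea Eb refl ea eb dc with triE-split Ea Eb TG
...   | Ea* , Eb* , refl , TA , TB =
  ⇒-cast refl (cong μ_ (sself-fuse Ea* Eb* d*)) (t6 (⇒c-ssub (sself⇒ (triE TB eb)) (Td dc)) (triE TA ea))
triSkelμ (suc m) {d* = d*} s nt Td TG dY with sk-step s dY
... | sk-smaller s' dY' = triSkelμ m s' nt Td TG dY'
... | sk-kept Aa Ab refl s' ea eb dw with triE-split Aa _ TG
...   | Aa* , R* , refl , TAa , TR =
  ⇒-cast refl (cong μ_ (sself-fuse Aa* R* d*)) (t6 (triSkelμ-wrapped m s' nt Td TR eb dw) (triE TAa ea))

triSkelμ-cmd : ∀ n {d d* G G* Z} → Sk d n G Z → NotT7 d → TriC d d* → TriE G G* →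
               ∀ α {c'} → [ α ] Z ⇒c c' → c' ⇒c ssubc (sout α G*) d*
triSkelμ-cmd n s nt Td TG α dc with inv-cmd dc
... | cmd-c1 dW = triSkelμ-under n s nt Td TG dW α
triSkelμ-cmd zero {d} (sk0 {G}) nt Td TG α dc | cmd-c2 eq dd de with plugμ-injective G _ d _ eq
... | refl , refl = ⇒c-ssub (sout⇒ α (triE TG de)) (Td dd)
triSkelμ-cmd (suc m) s nt Td TG α dc | cmd-c2 eq dd de with sk-cmd-step s eq dd de α
... | Z' , s' , dc' = triSkelμ-cmd m s' nt Td TG α dc'

triSkel7 : ∀ n {z z* G G* Z} → Sk ([ zero ] renμ suc z) n G Z → headμ z ≡ false → Tri z z* →
           TriE G G* → ∀ {Y} → Z ⇒ Y → Y ⇒ plug G* z*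
triSkel7 zero {z} (sk0 {G}) hz Tz TG dY with spine G ([ zero ] renμ suc z) dY
... | spine-t7 eq eG dw with wk-inj (proj₂ (cmd-injective eq))
...   | refl = plug⇒ (triE TG eG) (Tz dw)
triSkel7 zero {z* = z*} sk0 hz Tz TG dY | spine-t6 Ea Eb {Ea'} {Eb'} refl ea eb dc with wrap-view dc
... | wrap-c2 eq _ _ _ = ⊥-elim (not-headμ (sym eq) hz)
... | wrap-body {w} dw refl with triE-split Ea Eb TG
...   | Ea* , Eb* , refl , TA , TB =
  ⇒-cast (cong (λ x → plug Ea' (μ x)) (sym (sself-wrap Eb' w))) (sym (plug-compose Ea* Eb* z*))
         (plug⇒ (triE TA ea) (t7 (plug⇒ (triE TB eb) (Tz dw))))
triSkel7 (suc m) {z* = z*} s hz Tz TG dY with sk-step s dY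
... | sk-smaller s' dY' = triSkel7 m s' hz Tz TG dY'
... | sk-kept Aa Ab {Aa'} {Ab'} {w = w} refl s' ea eb dw with triE-split Aa _ TG
...   | Aa* , R* , refl , TAa , TR =
  ⇒-cast (cong (λ x → plug Aa' (μ x)) (sym (sself-wrap Ab' w))) (sym (plug-compose Aa* R* z*))
         (plug⇒ (triE TAa ea) (t7 (triSkel7 m (sk-plug s' Ab) hz Tz TR (plug⇒ eb dw))))

triSkel7-cmd : ∀ n {z z* G G* Z} → Sk ([ zero ] renμ suc z) n G Z → headμ z ≡ false → Tri z z* →
               TriE G G* → ∀ α {c'} → [ α ] Z ⇒c c' → c' ⇒c [ α ] plug G* z*
triSkel7-cmd n s hz Tz TG α dc with inv-cmd dc
... | cmd-c1 dW = c1 (triSkel7 n s hz Tz TG dW)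
triSkel7-cmd zero (sk0 {G}) hz Tz TG α dc | cmd-c2 {E' = E'} eq dd de
  with plugμ-injective G _ _ _ eq
... | refl , refl with wrap-view dd
...   | wrap-c2 eq' _ _ _ = ⊥-elim (not-headμ (sym eq') hz)
...   | wrap-body {w} dw refl =
  ⇒c-cast (cong ([ α ]_) (cong (plug E') (sym (sout-wk α E' w)))) refl (c1 (plug⇒ (triE TG de) (Tz dw)))
triSkel7-cmd (suc m) s hz Tz TG α dc | cmd-c2 eq dd de with sk-cmd-step s eq dd de α
... | Z' , s' , dc' = triSkel7-cmd m s' hz Tz TG α dc'

-- Sizes, the measure for the construction of complete developments.  A
-- head-μ term with a t7-redex μα.[α](u↑) at its head is larger than the
-- term F[u] obtained by erasing the binder.
mutual
  size : Tm → ℕ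
  size (` x) = 1
  size (ƛ t) = suc (size t)
  size (t · u) = suc (size t + size u)
  size (μ c) = suc (sizec c)
  size 𝟘 = 1
  size (S t) = suc (size t)
  size (nrec r s t) = suc (size r + size s + size t)

  sizec : Cmd → ℕ
  sizec ([ α ] t) = suc (size t)

sizeE : Ctx → ℕ
sizeE □ = 0
sizeE (E ·E u) = suc (sizeE E + size u)
sizeE (SE E) = suc (sizeE E)
sizeE (nrecE r s E) = suc (size r + size s + sizeE E)

mutual
  size-renμ : ∀ ρ t → size (renμ ρ t) ≡ size t
  size-renμ ρ (` x) = refl
  size-renμ ρ (ƛ t) = cong suc (size-renμ ρ t)
  size-renμ ρ (t · u) = cong₂ (λ a b → suc (a + b)) (size-renμ ρ t) (size-renμ ρ u)
  size-renμ ρ (μ c) = cong suc (sizec-renμ (ext ρ) c)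
  size-renμ ρ 𝟘 = refl
  size-renμ ρ (S t) = cong suc (size-renμ ρ t)
  size-renμ ρ (nrec r s t) = cong₃ (λ a b c → suc (a + b + c)) (size-renμ ρ r) (size-renμ ρ s) (size-renμ ρ t)

  sizec-renμ : ∀ ρ c → sizec (renμc ρ c) ≡ sizec c
  sizec-renμ ρ ([ α ] t) = cong suc (size-renμ ρ t)

size-plug : ∀ E t → size (plug E t) ≡ sizeE E + size t
size-plug □ t = refl
size-plug (E ·E u) t = cong suc (trans (cong (_+ size u) (size-plug E t)) (xy∙z≈xz∙y (sizeE E) (size t) (size u)))
size-plug (SE E) t = cong suc (size-plug E t)
size-plug (nrecE r s E) t =
  cong suc (trans (cong (size r + size s +_) (size-plug E t)) (sym (+-assoc (size r + size s) (sizeE E) (size t))))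

size-nonzero : ∀ t → size t ≤ 0 → ⊥
size-nonzero (` x) ()
size-nonzero (ƛ t) ()
size-nonzero (t · t₁) ()
size-nonzero (μ x) ()
size-nonzero 𝟘 ()
size-nonzero (S t) ()
size-nonzero (nrec t t₁ t₂) ()

-- Deciding whether a command is a t7-redex body [0](u↑), via an occurrence
-- check for the μ-variable 0.
mutual
  occ : ℕ → Tm → Bool
  occ k (` x)        = false
  occ k (ƛ t)        = occ k t
  occ k (t · u)      = occ k t ∨ occ k u
  occ k (μ c)        = occc (suc k) c
  occ k 𝟘            = false
  occ k (S t)        = occ k t
  occ k (nrec r s t) = occ k r ∨ occ k s ∨ occ k t

  occc : ℕ → Cmd → Bool
  occc k ([ α ] t) = (α ≡ᵇ k) ∨ occ k t

≡ᵇ-false⇒≢ : ∀ m n → (m ≡ᵇ n) ≡ false → m ≢ n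
≡ᵇ-false⇒≢ m n e p = subst T e (≡⇒≡ᵇ m n p)

≢⇒≡ᵇ-false : ∀ m n → m ≢ n → (m ≡ᵇ n) ≡ false
≢⇒≡ᵇ-false m n ne with m ≡ᵇ n in e
... | false = refl
... | true  = ⊥-elim (ne (≡ᵇ⇒≡ m n (subst T (sym e) _)))

ext-inv : ∀ {k ρ σ} → (∀ x → x ≢ k → ρ (σ x) ≡ x) → ∀ x → x ≢ suc k → ext ρ (ext σ x) ≡ x
ext-inv h zero    ne = refl
ext-inv h (suc x) ne = cong suc (h x (λ e → ne (cong suc e)))

mutual
  occ-inv : ∀ {k ρ σ} → (∀ x → x ≢ k → ρ (σ x) ≡ x) → ∀ t → occ k t ≡ false →
            renμ ρ (renμ σ t) ≡ t
  occ-inv h (` x)   e = refl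
  occ-inv h (ƛ t)   e = cong ƛ_ (occ-inv h t e)
  occ-inv h (t · u) e = cong₂ _·_ (occ-inv h t (∨-conicalˡ _ _ e)) (occ-inv h u (∨-conicalʳ _ _ e))
  occ-inv h (μ c)   e = cong μ_ (occc-inv (ext-inv h) c e)
  occ-inv h 𝟘       e = refl
  occ-inv h (S t)   e = cong S_ (occ-inv h t e)
  occ-inv {k} h (nrec r s t) e =
    cong₃ nrec (occ-inv h r (∨-conicalˡ _ _ e))
               (occ-inv h s (∨-conicalˡ (occ k s) (occ k t) (∨-conicalʳ (occ k r) _ e)))
               (occ-inv h t (∨-conicalʳ (occ k s) (occ k t) (∨-conicalʳ (occ k r) _ e)))

  occc-inv : ∀ {k ρ σ} → (∀ x → x ≢ k → ρ (σ x) ≡ x) → ∀ c → occc k c ≡ false →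
             renμc ρ (renμc σ c) ≡ c
  occc-inv {k} h ([ α ] t) e =
    cong₂ [_]_ (h α (≡ᵇ-false⇒≢ α k (∨-conicalˡ _ _ e))) (occ-inv h t (∨-conicalʳ _ _ e))

ext-miss : ∀ {k ρ} → (∀ x → ρ x ≢ k) → ∀ x → ext ρ x ≢ suc k
ext-miss h zero    ()
ext-miss h (suc x) e = h x (suc-injective e)

mutual
  occ-ren : ∀ {k ρ} → (∀ x → ρ x ≢ k) → ∀ t → occ k (renμ ρ t) ≡ false
  occ-ren h (` x)        = refl
  occ-ren h (ƛ t)        = occ-ren h t
  occ-ren h (t · u)      = cong₂ _∨_ (occ-ren h t) (occ-ren h u)
  occ-ren h (μ c)        = occc-ren (ext-miss h) c
  occ-ren h 𝟘            = refl
  occ-ren h (S t)        = occ-ren h t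
  occ-ren h (nrec r s t) = cong₂ _∨_ (occ-ren h r) (cong₂ _∨_ (occ-ren h s) (occ-ren h t))

  occc-ren : ∀ {k ρ} → (∀ x → ρ x ≢ k) → ∀ c → occc k (renμc ρ c) ≡ false
  occc-ren {k} {ρ} h ([ α ] t) = cong₂ _∨_ (≢⇒≡ᵇ-false (ρ α) k (h α)) (occ-ren h t)

t7-redex? : ∀ c → (Σ Tm λ u → c ≡ [ zero ] renμ suc u) ⊎ NotT7 c
t7-redex? ([ suc k ] t) = inj₂ (λ u ())
t7-redex? ([ zero ] t) with occ zero t in e
... | false = inj₁ (renμ pred t , cong ([ zero ]_) (sym (occ-inv pred-suc t e)))
  where pred-suc : ∀ x → x ≢ zero → suc (pred x) ≡ x
        pred-suc zero    ne = ⊥-elim (ne refl)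
        pred-suc (suc x) ne = refl
... | true = inj₂ λ u eq →
  true≢false (trans (sym e) (trans (cong (occ zero) (proj₂ (cmd-injective eq))) (occ-ren (λ x ()) u)))

-- Triangle property for terms that are not head-μ.  Here no μ-rule applies at
-- the root, and the development contracts the β- and nrec-redex at the root,
-- if any, and develops the subterms.
isLam : Tm → Bool
isLam (ƛ _) = true
isLam _ = false

isNum : Tm → Bool
isNum 𝟘 = true
isNum (S t) = isNum t
isNum _ = false

nrecArg : Tm → Bool
nrecArg 𝟘 = true
nrecArg (S t) = isNum t
nrecArg _ = false

isNum-num : ∀ n → isNum (num n) ≡ true
isNum-num zero = refl
isNum-num (suc n) = isNum-num n

isNum-true : ∀ t → isNum t ≡ true → Σ ℕ λ n → t ≡ num n
isNum-true 𝟘 e = zero , refl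
isNum-true (S t) e with isNum-true t e
... | n , refl = suc n , refl
isNum-true (` x) ()
isNum-true (ƛ t) ()
isNum-true (t · t₁) ()
isNum-true (μ x) ()
isNum-true (nrec t t₁ t₂) ()

nrecArg-true : ∀ t → nrecArg t ≡ true → (t ≡ 𝟘) ⊎ (Σ ℕ λ n → t ≡ S num n)
nrecArg-true 𝟘 e = inj₁ refl
nrecArg-true (S t) e with isNum-true t e
... | n , refl = inj₂ (n , refl)
nrecArg-true (` x) ()
nrecArg-true (ƛ t) ()
nrecArg-true (t · t₁) ()
nrecArg-true (μ x) ()
nrecArg-true (nrec t t₁ t₂) ()

triLam : ∀ {b b*} → Tri b b* → Tri (ƛ b) (ƛ b*)
triLam Tb d with inv-lam d refl
... | b' , refl , db = t3 (Tb db)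

triS : ∀ {t t*} → headμ t ≡ false → Tri t t* → Tri (S t) (S t*)
triS e Tt d with inv-S d refl
... | s-cong d' = S⇒ (Tt d')
... | s-mu eq _ _ = ⊥-elim (not-headμ (sym eq) e)

triBeta : ∀ {b b* u u*} → Tri b b* → Tri u u* → Tri ((ƛ b) · u) (b* [0:= u* ])
triBeta Tb Tu d with inv-app d refl
... | a-cong d1 du with inv-lam d1 refl
...   | b' , refl , db = t5 (Tb db) (Tu du)
triBeta Tb Tu d | a-beta refl db du = ⇒-inst (Tb db) (Tu du)
triBeta Tb Tu d | a-mu eq _ _ _ = ⊥-elim (not-headμ (sym eq) refl)

triApp : ∀ {t t* u u*} → isLam t ≡ false → headμ t ≡ false → Tri t t* → Tri u u* → Tri (t · u) (t* · u*)
triApp el e Tt Tu d with inv-app d refl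
... | a-cong d1 du = app⇒ (Tt d1) (Tu du)
... | a-beta eq _ _ = ⊥-elim (true≢false (trans (sym (cong isLam eq)) el))
... | a-mu eq _ _ _ = ⊥-elim (not-headμ (sym eq) e)

triNrec : ∀ {r r* s s* t t*} → nrecArg t ≡ false → headμ t ≡ false → Tri r r* → Tri s s* → Tri t t* →
          Tri (nrec r s t) (nrec r* s* t*)
triNrec ea e Tr Ts Tt d with inv-nrec d refl
... | n-cong dr ds dt = nrec⇒ (Tr dr) (Ts ds) (Tt dt)
... | n-zero eq _ = ⊥-elim (true≢false (trans (sym (cong nrecArg eq)) ea))
... | n-suc {n = k} eq _ _ = ⊥-elim (true≢false (trans (sym (trans (cong nrecArg eq) (isNum-num k))) ea))
... | n-mu eq _ _ _ _ = ⊥-elim (not-headμ (sym eq) e)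

triNrec-zero : ∀ {r r* s} → Tri r r* → Tri (nrec r s 𝟘) r*
triNrec-zero Tr d with inv-nrec d refl
... | n-cong dr ds d0 with inv-zero d0 refl
...   | refl = t8 (Tr dr)
triNrec-zero Tr d | n-zero _ dr = Tr dr
triNrec-zero Tr d | n-suc () _ _
triNrec-zero Tr d | n-mu eq _ _ _ _ = ⊥-elim (not-headμ (sym eq) refl)

triNrec-suc : ∀ {r r* s s*} m → Tri r r* → Tri s s* → Tri (nrec r s (S num m)) (s* · num m · nrec r* s* (num m))
triNrec-suc m Tr Ts d with inv-nrec d refl
... | n-cong dr ds d0 with inv-num (suc m) d0
...   | refl = t9 (Tr dr) (Ts ds)
triNrec-suc m Tr Ts d | n-zero () _
triNrec-suc m Tr Ts d | n-suc {n = k} eq dr ds with num-injective m k (S-injective eq)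
... | refl = app⇒ (app⇒ (Ts ds) (num⇒ m)) (nrec⇒ (Tr dr) (Ts ds) (num⇒ m))
triNrec-suc m Tr Ts d | n-mu eq _ _ _ _ = ⊥-elim (not-headμ (sym eq) (headμ-num (suc m)))

triCmd-nonheadμ : ∀ {α t t*} → headμ t ≡ false → Tri t t* → TriC ([ α ] t) ([ α ] t*)
triCmd-nonheadμ e Tt d with inv-cmd d
... | cmd-c1 d' = c1 (Tt d')
... | cmd-c2 eq _ _ = ⊥-elim (not-headμ (sym eq) e)

data CoreAnalysis (t : Tm) : Set where
  core-μ : ∀ {n G G* d d*} → Sk d n G t → NotT7 d → TriC d d* → TriE G G* → CoreAnalysis t
  core-t7 : ∀ {n G G* z z*} → Sk ([ zero ] renμ suc z) n G t → headμ z ≡ false → Tri z z* → TriE G G* → CoreAnalysis t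

core-development : ∀ {t} → CoreAnalysis t → Σ Tm (Tri t)
core-development (core-μ s nt Td TG) = _ , triSkelμ _ s nt Td TG
core-development (core-t7 s hz Tz TG) = _ , triSkel7 _ s hz Tz TG

size-plugμ-bound : ∀ {n} F c → size (plug F (μ c)) ≤ suc n → (sizeE F ≤ n) × (sizec c ≤ n)
size-plugμ-bound {n} F c h = m+n≤o⇒m≤o (sizeE F) bound , m+n≤o⇒n≤o (sizeE F) bound
  where bound : sizeE F + sizec c ≤ n
        bound = ≤-pred (subst (_≤ suc n) (trans (size-plug F (μ c)) (+-suc (sizeE F) (sizec c))) h)

size-wrap-bound : ∀ {n} F u → size (plug F (μ ([ zero ] renμ suc u))) ≤ suc n →
                  (size (plug F u) ≤ n) × (size u ≤ n)
size-wrap-bound {n} F u h = subst (_≤ n) (sym (size-plug F u)) bound , m+n≤o⇒n≤o (sizeE F) bound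
  where open ≡-Reasoning
        size-wrapped : size (plug F (μ ([ zero ] renμ suc u))) ≡ suc (suc (sizeE F + size u))
        size-wrapped = begin
          size (plug F (μ ([ zero ] renμ suc u)))  ≡⟨ size-plug F _ ⟩
          sizeE F + suc (suc (size (renμ suc u)))  ≡⟨ cong (λ z → sizeE F + suc (suc z)) (size-renμ suc u) ⟩
          sizeE F + suc (suc (size u))             ≡⟨ +-suc (sizeE F) _ ⟩
          suc (sizeE F + suc (size u))             ≡⟨ cong suc (+-suc (sizeE F) _) ⟩
          suc (suc (sizeE F + size u))             ∎
        bound : sizeE F + size u ≤ n
        bound = ≤-trans (n≤1+n _) (≤-pred (subst (_≤ suc n) size-wrapped h))

+-bound₂ : ∀ {n} a b → suc (a + b) ≤ suc n → (a ≤ n) × (b ≤ n)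
+-bound₂ a b h = m+n≤o⇒m≤o a (≤-pred h) , m+n≤o⇒n≤o a (≤-pred h)

+-bound₃ : ∀ {n} a b c → suc (a + b + c) ≤ suc n → (a ≤ n) × (b ≤ n) × (c ≤ n)
+-bound₃ a b c h with +-bound₂ (a + b) c h
... | ab , c≤n = m+n≤o⇒m≤o a ab , m+n≤o⇒n≤o a ab , c≤n

extend-analysis : ∀ F u → CoreAnalysis (plug F u) → CoreAnalysis (plug F (μ ([ zero ] renμ suc u)))
extend-analysis F u (core-μ s nt Td TG) with sk-peel s F u refl
... | H , refl , s' = core-μ (sk+ F s') nt Td TG
extend-analysis F u (core-t7 s hz Tz TG) with sk-peel s F u refl
... | H , refl , s' = core-t7 (sk+ F s') hz Tz TG

-- A
-- head-μ term F[μc] is analysed; when c = [0](u↑) with u head-μ, the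
-- analysis of the smaller term F[u] is extended by one wrapper.
mutual
  develop : ∀ n t → size t ≤ n → Σ Tm (Tri t)
  develop zero t h = ⊥-elim (size-nonzero t h)
  develop (suc n) t h with headμ t in e
  ... | true = core-development (analyse n t e h)
  ... | false = develop-nonheadμ n t e h

  develop-nonheadμ : ∀ n t → headμ t ≡ false → size t ≤ suc n → Σ Tm (Tri t)
  develop-nonheadμ n (` x) e h = ` x , λ d → ⇒-cast (sym (inv-var d refl)) refl t1
  develop-nonheadμ n (ƛ b) e h with develop n b (≤-pred h)
  ... | b* , Tb = ƛ b* , triLam Tb
  develop-nonheadμ n (t · u) e h with isLam t in el | +-bound₂ (size t) (size u) h
  develop-nonheadμ n ((ƛ b) · u) e h | true | ht , hu with develop n b (≤-trans (n≤1+n _) ht) | develop n u hu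
  ... | b* , Tb | u* , Tu = b* [0:= u* ] , triBeta Tb Tu
  develop-nonheadμ n (t · u) e h | false | ht , hu with develop n t ht | develop n u hu
  ... | t* , Tt | u* , Tu = t* · u* , triApp el e Tt Tu
  develop-nonheadμ n (μ c) () h
  develop-nonheadμ n 𝟘 e h = 𝟘 , λ d → ⇒-cast (sym (inv-zero d refl)) refl t2
  develop-nonheadμ n (S t) e h with develop n t (≤-pred h)
  ... | t* , Tt = S t* , triS e Tt
  develop-nonheadμ n (nrec r s t) e h with nrecArg t in ea | +-bound₃ (size r) (size s) (size t) h
  ... | false | hr , hs , ht with develop n r hr | develop n s hs | develop n t ht
  ...   | r* , Tr | s* , Ts | t* , Tt = nrec r* s* t* , triNrec ea e Tr Ts Tt
  develop-nonheadμ n (nrec r s t) e h | true | hr , hs , ht with nrecArg-true t ea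
  ... | inj₁ refl with develop n r hr
  ...   | r* , Tr = r* , triNrec-zero Tr
  develop-nonheadμ n (nrec r s t) e h | true | hr , hs , ht | inj₂ (m , refl) with develop n r hr | develop n s hs
  ...   | r* , Tr | s* , Ts = s* · num m · nrec r* s* (num m) , triNrec-suc m Tr Ts

  analyse : ∀ n t → headμ t ≡ true → size t ≤ suc n → CoreAnalysis t
  analyse n t e h with headμ-decompose t e
  ... | F , c , refl with size-plugμ-bound F c h | t7-redex? c
  ...   | hF , hc | inj₂ nt with developE n F hF | developC n c hc
  ...     | F* , TF | c* , Tc = core-μ sk0 nt Tc TF
  analyse n t e h | F , c , refl | hF , hc | inj₁ (u , refl) with headμ u in eu | size-wrap-bound F u h
  ... | false | hFu , hu with developE n F hF | develop n u hu
  ...   | F* , TF | u* , Tu = core-t7 sk0 eu Tu TF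
  analyse zero t e h | F , c , refl | hF , hc | inj₁ (u , refl) | true | hFu , hu =
    ⊥-elim (size-nonzero (plug F u) hFu)
  analyse (suc n) t e h | F , c , refl | hF , hc | inj₁ (u , refl) | true | hFu , hu =
    extend-analysis F u (analyse n (plug F u) (trans (headμ-plug F u) eu) hFu)

  developC : ∀ n c → sizec c ≤ n → Σ Cmd (TriC c)
  developC zero ([ α ] t) ()
  developC (suc n) ([ α ] t) h with headμ t in e
  ... | false with develop n t (≤-pred h)
  ...   | t* , Tt = [ α ] t* , triCmd-nonheadμ e Tt
  developC (suc n) ([ α ] t) h | true with analyse n t e (≤-trans (≤-pred h) (n≤1+n n))
  ... | core-μ s nt Td TG = _ , triSkelμ-cmd _ s nt Td TG α
  ... | core-t7 s hz Tz TG = _ , triSkel7-cmd _ s hz Tz TG α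

  developE : ∀ n E → sizeE E ≤ n → Σ Ctx (TriE E)
  developE n □ h = □ , te□
  developE zero (E ·E u) ()
  developE (suc n) (E ·E u) h with +-bound₂ (sizeE E) (size u) h
  ... | hE , hu with developE n E hE | develop n u hu
  ...   | E* , TE | u* , Tu = (E* ·E u*) , te· TE Tu
  developE zero (SE E) ()
  developE (suc n) (SE E) h with developE n E (≤-pred h)
  ... | E* , TE = SE E* , teS TE
  developE zero (nrecE r s E) ()
  developE (suc n) (nrecE r s E) h with +-bound₃ (size r) (size s) (sizeE E) h
  ... | hr , hs , hE with developE n E hE | develop n r hr | develop n s hs
  ...   | E* , TE | r* , Tr | s* , Ts = nrecE r* s* E* , ten TE Tr Ts

development : ∀ t → Σ Tm (Tri t)
development t = develop (size t) t ≤-refl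

corollary5p15 : ∀ {t₁ t₂ t₃ : Tm} → t₁ ⇒ t₂ → t₁ ⇒ t₃ →
    Σ Tm (λ t₄ → (t₂ ⇒ t₄) × (t₃ ⇒ t₄))
corollary5p15 {t₁} d₂ d₃ with development t₁
... | t* , tri = t* , tri d₂ , tri d₃
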